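{- Let $a$ and $b$ be odd positive integers with $\gcd(a,b)=1$, and let $p,n\in\mathbb{N}_0$. Then $$\int_0^1\overline{E}_p(ax)\,\overline{E}_{n}(bx)\,dx=\frac{2(-1)^{n+1}}{(n+1)\binom{p+n+1}{n+1}}\cdot\frac{1}{a^{n+1}b^{p+1}}\,E_{p+n+1}(0).$$
   Context: The Euler polynomials $E_k(x)$, $k\in\mathbb{N}_0$, are defined by $\frac{2e^{xt}}{e^t+1}=\sum_{k=0}^\infty E_k(x)\frac{t^k}{k!}$. The quasi-periodic Euler function is $\overline{E}_k(x)=(-1)^{[x]}E_k(\{x\})$ for real $x$, where $[x]$ is the greatest integer not exceeding $x$ and $\{x\}=x-[x]$. -}

module Defs where

open import Data.Nat as ℕ using (ℕ; zero; suc; NonZero; _%_)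
open import Data.Nat.Combinatorics using (_C_)
open import Data.Integer as ℤ using (ℤ; +_; ∣_∣)
open import Data.Rational as ℚ using (ℚ; 0ℚ; 1ℚ; _+_; _*_; _-_; -_; _<_; floor)
open import Data.List using (List; []; _∷_; _++_; foldr; length; reverse)
open import Data.Product using (_×_)
open import Relation.Binary.PropositionalEquality using (_≡_)

ℕ→ℚ : ℕ → ℚ
ℕ→ℚ n = (+ n) ℚ./ 1

-- reciprocal of a natural number (only ever applied to nonzero values;
-- the value at 0 is an irrelevant convention)
recip : ℕ → ℚ
recip zero    = 0ℚ
recip (suc k) = (+ 1) ℚ./ suc k

sgnℕ : ℕ → ℚ
sgnℕ zero    = 1ℚ
sgnℕ (suc m) = - sgnℕ m

sgnℤ : ℤ → ℚ
sgnℤ z = sgnℕ ∣ z ∣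

_^ℚ_ : ℚ → ℕ → ℚ
q ^ℚ zero  = 1ℚ
q ^ℚ suc m = q * (q ^ℚ m)

-- Polynomials over ℚ as coefficient lists (constant term first)

Poly : Set
Poly = List ℚ

eval : Poly → ℚ → ℚ
eval []       x = 0ℚ
eval (c ∷ cs) x = c + x * eval cs x

_+ₚ_ : Poly → Poly → Poly
[]       +ₚ q        = q
(c ∷ cs) +ₚ []       = c ∷ cs
(c ∷ cs) +ₚ (d ∷ ds) = (c + d) ∷ (cs +ₚ ds)

scaleₚ : ℚ → Poly → Poly
scaleₚ r []       = []
scaleₚ r (c ∷ cs) = r * c ∷ scaleₚ r cs

monoₚ : ℕ → Poly
monoₚ zero    = 1ℚ ∷ []
monoₚ (suc k) = 0ℚ ∷ monoₚ k

-- Comparing coefficients of t^k/k! in  2 e^{xt} = (e^t + 1) Σ E_k(x) t^k/k!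
-- gives  Σ_{j=0}^{k} C(k,j) E_j(x) + E_k(x) = 2 x^k, i.e.
--   E_k(x) = x^k - (1/2) Σ_{j<k} C(k,j) E_j(x).
-- eulerList k = [E_0, ..., E_{k}] (in this order).

private
  binomSum : ℕ → ℕ → List Poly → Poly
  binomSum k j []       = []
  binomSum k j (e ∷ es) = scaleₚ (ℕ→ℚ (k C j)) e +ₚ binomSum k (suc j) es

half : ℚ
half = (+ 1) ℚ./ 2

eulerList : ℕ → List Poly
eulerList zero    = (1ℚ ∷ []) ∷ []
eulerList (suc k) =
  eulerList k ++ ((monoₚ (suc k) +ₚ scaleₚ (- half) (binomSum (suc k) 0 (eulerList k))) ∷ [])

private
  last : Poly → List Poly → Poly
  last d []       = d
  last d (e ∷ es) = last e es

EulerPoly : ℕ → Poly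
EulerPoly k = last [] (eulerList k)

E : ℕ → ℚ → ℚ
E k x = eval (EulerPoly k) x

Ebar : ℕ → ℚ → ℚ
Ebar k x = sgnℤ (floor x) * E k (x - ((floor x) ℚ./ 1))

-- A representation of f : ℚ → ℚ as piecewise polynomial on [0,1]:
-- a number N > 0 of equal cells and, for each cell k < N, a polynomial
-- that agrees with f on the open cell (k/N, (k+1)/N).

private
  antideriv' : ℕ → Poly → Poly
  antideriv' i []       = []
  antideriv' i (c ∷ cs) = recip (suc i) * c ∷ antideriv' (suc i) cs

antideriv : Poly → Poly
antideriv p = 0ℚ ∷ antideriv' 0 p

∫poly : Poly → ℚ → ℚ → ℚ
∫poly p l u = eval (antideriv p) u - eval (antideriv p) l

record PiecewisePoly01 (f : ℚ → ℚ) : Set where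
  field
    cells     : ℕ
    .{{cells≢0}} : NonZero cells
    piece     : ℕ → Poly
    agrees    : ∀ (k : ℕ) → k ℕ.< cells → ∀ (x : ℚ) →
                  ((+ k) ℚ./ cells) < x → x < ((+ suc k) ℚ./ cells) →
                  f x ≡ eval (piece k) x


∫₀¹ : ∀ {f} → PiecewisePoly01 f → ℚ
∫₀¹ R = go (cells R)
  where
  open PiecewisePoly01
  go : ℕ → ℚ
  go zero    = 0ℚ
  go (suc k) = go k + ∫poly (piece R k) ((+ k) ℚ./ cells R) ((+ suc k) ℚ./ cells R)

module Submission where

-- Both factors are polynomial on each of the a b equal cells of [0, 1], so the integral is a finite
-- sum of polynomial integrals, and it does not depend on the chosen piecewise representation.
-- Integrating by parts cell by cell (E_k' = k E_{k-1}, and Ē_k is continuous for k ≥ 1) gives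
--   I(p, n + 1) = - (b (n + 1) / (a (p + 1))) I(p + 1, n),
-- the boundary terms cancelling because a and b are odd. At n = 0, Ē_0(b x) = (-1)^⌊b x⌋ and the
-- integral becomes an alternating sum of the values Ē_{p+1}(j a / b), j < b. As j a mod b runs over
-- all residues (gcd(a, b) = 1), the multiplication theorem b^M Σ_r (-1)^r E_M(r / b) = E_M(0)
-- (b odd) evaluates it.

open import Data.Nat using (ℕ)

module Arithmetic where

  open import Level using (0ℓ)
  open import Data.Nat as ℕ using (ℕ; zero; suc; NonZero)
  import Data.Nat.Properties as ℕ
  open import Data.Nat.DivMod using (_/_; _%_; m≡m%n+[m/n]*n; [m+kn]%n≡m%n; m<n⇒m%n≡m; m%n<n)
  import Data.Nat.Tactic.RingSolver as ℕ-Solver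
  import Data.Nat.Coprimality as Coprimality
  open import Data.Integer as ℤ using (+_)
  import Data.Integer.Properties as ℤ
  open import Data.Rational as ℚ using (ℚ; 0ℚ; 1ℚ; _+_; _*_; _-_; -_; _<_; _≤_; mkℚ; 1/_)
  open import Data.Rational.Properties
  open import Data.Product using (_×_; _,_)
  open import Relation.Binary.PropositionalEquality
  open import Relation.Nullary.Decidable.Core using (dec⇒maybe)
  open import Tactic.RingSolver using (solve-∀)
  open import Tactic.RingSolver.Core.AlmostCommutativeRing using (AlmostCommutativeRing; fromCommutativeRing)
  import Algebra.Properties.Group as GroupProperties
  open import Defs
  open ≡-Reasoning

  ℚ-ring : AlmostCommutativeRing 0ℓ 0ℓ
  ℚ-ring = fromCommutativeRing +-*-commutativeRing (λ x → dec⇒maybe (0ℚ ℚ.≟ x))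

  open GroupProperties +-0-group public using ()
    renaming (x∙y⁻¹≈ε⇒x≈y to x-y≡0⇒x≡y; inverseˡ-unique to x+y≡0⇒x≡-y; ⁻¹-involutive to neg-involutive)

  two : ℚ
  two = 1ℚ + 1ℚ

  -- i/n as a rational number (with i ÷ 0 = 0, as recip 0 = 0)
  infixl 7 _÷_
  _÷_ : ℕ → ℕ → ℚ
  i ÷ n = ℕ→ℚ i * recip n

  ℕ→ℚ≡mkℚ : ∀ n → ℕ→ℚ n ≡ mkℚ (+ n) 0 (Coprimality.sym (Coprimality.1-coprimeTo n))
  ℕ→ℚ≡mkℚ n = normalize-coprime (Coprimality.sym (Coprimality.1-coprimeTo n))

  recip≡mkℚ : ∀ k → recip (suc k) ≡ mkℚ (+ 1) k (Coprimality.1-coprimeTo (suc k))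
  recip≡mkℚ k = normalize-coprime (Coprimality.1-coprimeTo (suc k))

  ℕ→ℚ-homo-+ : ∀ m n → ℕ→ℚ (m ℕ.+ n) ≡ ℕ→ℚ m + ℕ→ℚ n
  ℕ→ℚ-homo-+ m n = sym (begin
    ℕ→ℚ m + ℕ→ℚ n                                ≡⟨ cong₂ _+_ (ℕ→ℚ≡mkℚ m) (ℕ→ℚ≡mkℚ n) ⟩
    (+ m ℤ.* + 1 ℤ.+ + n ℤ.* + 1) ℚ./ 1         ≡⟨ cong₂ (λ u v → (u ℤ.+ v) ℚ./ 1) (ℤ.*-identityʳ (+ m)) (ℤ.*-identityʳ (+ n)) ⟩
    ℕ→ℚ (m ℕ.+ n)                                ∎)

  ℕ→ℚ-homo-* : ∀ m n → ℕ→ℚ (m ℕ.* n) ≡ ℕ→ℚ m * ℕ→ℚ n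
  ℕ→ℚ-homo-* m n = sym (trans (cong₂ _*_ (ℕ→ℚ≡mkℚ m) (ℕ→ℚ≡mkℚ n)) (cong (ℚ._/ 1) (sym (ℤ.pos-* m n))))

  ℕ→ℚ-suc : ∀ n → ℕ→ℚ (suc n) ≡ 1ℚ + ℕ→ℚ n
  ℕ→ℚ-suc = ℕ→ℚ-homo-+ 1

  ℕ→ℚ-injective : ∀ {m n} → ℕ→ℚ m ≡ ℕ→ℚ n → m ≡ n
  ℕ→ℚ-injective {m} {n} eq with mkℚ-injective (trans (sym (ℕ→ℚ≡mkℚ m)) (trans eq (ℕ→ℚ≡mkℚ n)))
  ... | refl , _ = refl

  ℕ→ℚ-suc≢0 : ∀ k → ℕ→ℚ (suc k) ≢ 0ℚ
  ℕ→ℚ-suc≢0 k eq with ℕ→ℚ-injective {suc k} {0} eq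
  ... | ()

  ℕ→ℚ-mono-< : ∀ {m n} → m ℕ.< n → ℕ→ℚ m < ℕ→ℚ n
  ℕ→ℚ-mono-< {m} {n} m<n rewrite ℕ→ℚ≡mkℚ m | ℕ→ℚ≡mkℚ n =
    ℚ.*<* (subst₂ ℤ._<_ (sym (ℤ.*-identityʳ (+ m))) (sym (ℤ.*-identityʳ (+ n))) (ℤ.+<+ m<n))

  ℕ→ℚ-mono-≤ : ∀ {m n} → m ℕ.≤ n → ℕ→ℚ m ≤ ℕ→ℚ n
  ℕ→ℚ-mono-≤ {m} {n} m≤n rewrite ℕ→ℚ≡mkℚ m | ℕ→ℚ≡mkℚ n =
    ℚ.*≤* (subst₂ ℤ._≤_ (sym (ℤ.*-identityʳ (+ m))) (sym (ℤ.*-identityʳ (+ n))) (ℤ.+≤+ m≤n))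

  ℕ→ℚ-pos : ∀ k → ℚ.Positive (ℕ→ℚ (suc k))
  ℕ→ℚ-pos k = subst ℚ.Positive (sym (ℕ→ℚ≡mkℚ (suc k))) _

  recip-pos : ∀ k → ℚ.Positive (recip (suc k))
  recip-pos k = subst ℚ.Positive (sym (recip≡mkℚ k)) _

  recip-injective : ∀ m n → recip (suc m) ≡ recip (suc n) → m ≡ n
  recip-injective m n eq with mkℚ-injective (trans (sym (recip≡mkℚ m)) (trans eq (recip≡mkℚ n)))
  ... | _ , m≡n = m≡n

  recip-inverseʳ : ∀ k → ℕ→ℚ (suc k) * recip (suc k) ≡ 1ℚ
  recip-inverseʳ k rewrite ℕ→ℚ≡mkℚ (suc k) | recip≡mkℚ k =
    *-inverseʳ (mkℚ (+ suc k) 0 (Coprimality.sym (Coprimality.1-coprimeTo (suc k))))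

  recip-homo-* : ∀ m n → recip (m ℕ.* n) ≡ recip m * recip n
  recip-homo-* zero    n       = sym (*-zeroˡ (recip n))
  recip-homo-* (suc m) zero    rewrite ℕ.*-zeroʳ m = sym (*-zeroʳ (recip (suc m)))
  recip-homo-* (suc m) (suc n) = sym (cong₂ _*_ (recip≡mkℚ m) (recip≡mkℚ n))

  recip-homo-^ : ∀ m n → recip (m ℕ.^ n) ≡ recip m ^ℚ n
  recip-homo-^ m zero    = refl
  recip-homo-^ m (suc n) = trans (recip-homo-* m (m ℕ.^ n)) (cong (recip m *_) (recip-homo-^ m n))

  +/≡÷ : ∀ i n .{{_ : NonZero n}} → (+ i) ℚ./ n ≡ i ÷ n
  +/≡÷ i (suc n) = sym (begin
    ℕ→ℚ i * recip (suc n)                    ≡⟨ cong₂ _*_ (ℕ→ℚ≡mkℚ i) (recip≡mkℚ n) ⟩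
    (+ i ℤ.* + 1) ℚ./ (1 ℕ.* suc n)          ≡⟨ /-cong (ℤ.*-identityʳ (+ i)) (ℕ.*-identityˡ (suc n)) ⟩
    (+ i) ℚ./ suc n                          ∎)

  *÷-cancelʳ : ∀ m d → (m ℕ.* suc d) ÷ suc d ≡ ℕ→ℚ m
  *÷-cancelʳ m d = begin
    ℕ→ℚ (m ℕ.* suc d) * recip (suc d)            ≡⟨ cong (_* recip (suc d)) (ℕ→ℚ-homo-* m (suc d)) ⟩
    ℕ→ℚ m * ℕ→ℚ (suc d) * recip (suc d)          ≡⟨ *-assoc (ℕ→ℚ m) (ℕ→ℚ (suc d)) (recip (suc d)) ⟩
    ℕ→ℚ m * (ℕ→ℚ (suc d) * recip (suc d))        ≡⟨ cong (ℕ→ℚ m *_) (recip-inverseʳ d) ⟩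
    ℕ→ℚ m * 1ℚ                                   ≡⟨ *-identityʳ (ℕ→ℚ m) ⟩
    ℕ→ℚ m                                        ∎

  *÷*-cancelʳ : ∀ m n k → (m ℕ.* suc k) ÷ (n ℕ.* suc k) ≡ m ÷ n
  *÷*-cancelʳ m n k = begin
    ℕ→ℚ (m ℕ.* suc k) * recip (n ℕ.* suc k)          ≡⟨ cong₂ _*_ (ℕ→ℚ-homo-* m (suc k)) (recip-homo-* n (suc k)) ⟩
    ℕ→ℚ m * K * (recip n * recip (suc k))            ≡⟨ regroup (ℕ→ℚ m) K (recip n) (recip (suc k)) ⟩
    ℕ→ℚ m * recip n * (K * recip (suc k))            ≡⟨ cong (m ÷ n *_) (recip-inverseʳ k) ⟩
    ℕ→ℚ m * recip n * 1ℚ                             ≡⟨ *-identityʳ (m ÷ n) ⟩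
    m ÷ n                                            ∎
    where
    K = ℕ→ℚ (suc k)
    regroup : ∀ a b c d → a * b * (c * d) ≡ a * c * (b * d)
    regroup = solve-∀ ℚ-ring

  ÷-mono-≤ : ∀ {i j} n → i ℕ.≤ j → i ÷ suc n ≤ j ÷ suc n
  ÷-mono-≤ n i≤j = *-monoʳ-≤-nonNeg (recip (suc n)) {{pos⇒nonNeg (recip (suc n)) {{recip-pos n}}}} (ℕ→ℚ-mono-≤ i≤j)

  ÷-mono-< : ∀ {i j} n → i ℕ.< j → i ÷ suc n < j ÷ suc n
  ÷-mono-< n i<j = *-monoˡ-<-pos (recip (suc n)) {{recip-pos n}} (ℕ→ℚ-mono-< i<j)

  m*recip[m*n]≡recip[n] : ∀ m n → ℕ→ℚ (suc m) * recip (suc m ℕ.* n) ≡ recip n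
  m*recip[m*n]≡recip[n] m n = begin
    ℕ→ℚ (suc m) * recip (suc m ℕ.* n)            ≡⟨ cong (ℕ→ℚ (suc m) *_) (recip-homo-* (suc m) n) ⟩
    ℕ→ℚ (suc m) * (recip (suc m) * recip n)      ≡⟨ sym (*-assoc (ℕ→ℚ (suc m)) (recip (suc m)) (recip n)) ⟩
    ℕ→ℚ (suc m) * recip (suc m) * recip n        ≡⟨ cong (_* recip n) (recip-inverseʳ m) ⟩
    1ℚ * recip n                                 ≡⟨ *-identityˡ (recip n) ⟩
    recip n                                      ∎

  m*[u÷m*n]≡u÷n : ∀ m n u → ℕ→ℚ (suc m) * (u ÷ (suc m ℕ.* n)) ≡ u ÷ n
  m*[u÷m*n]≡u÷n m n u = begin
    ℕ→ℚ (suc m) * (ℕ→ℚ u * recip (suc m ℕ.* n))   ≡⟨ commute (ℕ→ℚ (suc m)) (ℕ→ℚ u) (recip (suc m ℕ.* n)) ⟩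
    ℕ→ℚ u * (ℕ→ℚ (suc m) * recip (suc m ℕ.* n))   ≡⟨ cong (ℕ→ℚ u *_) (m*recip[m*n]≡recip[n] m n) ⟩
    u ÷ n                                         ∎
    where
    commute : ∀ x y z → x * (y * z) ≡ y * (x * z)
    commute = solve-∀ ℚ-ring

  u÷n-u/n≡u%n÷n : ∀ u n → u ÷ suc n - ℕ→ℚ (u / suc n) ≡ (u % suc n) ÷ suc n
  u÷n-u/n≡u%n÷n u n = begin
    ℕ→ℚ u * recip D - ℕ→ℚ q                        ≡⟨ cong (λ z → ℕ→ℚ z * recip D - ℕ→ℚ q) (m≡m%n+[m/n]*n u D) ⟩
    ℕ→ℚ (r ℕ.+ q ℕ.* D) * recip D - ℕ→ℚ q          ≡⟨ cong (λ z → z * recip D - ℕ→ℚ q) (ℕ→ℚ-homo-+ r (q ℕ.* D)) ⟩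
    (ℕ→ℚ r + ℕ→ℚ (q ℕ.* D)) * recip D - ℕ→ℚ q      ≡⟨ regroup (ℕ→ℚ r) (ℕ→ℚ (q ℕ.* D)) (recip D) (ℕ→ℚ q) ⟩
    r ÷ D + ((q ℕ.* D) ÷ D - ℕ→ℚ q)                ≡⟨ cong (λ z → r ÷ D + (z - ℕ→ℚ q)) (*÷-cancelʳ q n) ⟩
    r ÷ D + (ℕ→ℚ q - ℕ→ℚ q)                        ≡⟨ cong (λ z → r ÷ D + z) (+-inverseʳ (ℕ→ℚ q)) ⟩
    r ÷ D + 0ℚ                                     ≡⟨ +-identityʳ (r ÷ D) ⟩
    r ÷ D                                          ∎
    where
    D = suc n
    q = u / D
    r = u % D
    regroup : ∀ r y ρ q → (r + y) * ρ - q ≡ r * ρ + (y * ρ - q)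
    regroup = solve-∀ ℚ-ring

  *-zero-cancelˡ : ∀ x y → x ≢ 0ℚ → x * y ≡ 0ℚ → y ≡ 0ℚ
  *-zero-cancelˡ x y x≢0 xy≡0 = begin
    y                   ≡⟨ sym (*-identityˡ y) ⟩
    1ℚ * y              ≡⟨ cong (_* y) (sym (*-inverseˡ x)) ⟩
    (1/ x) * x * y      ≡⟨ *-assoc (1/ x) x y ⟩
    (1/ x) * (x * y)    ≡⟨ cong ((1/ x) *_) xy≡0 ⟩
    (1/ x) * 0ℚ         ≡⟨ *-zeroʳ (1/ x) ⟩
    0ℚ                  ∎
    where instance _ = ℚ.≢-nonZero x≢0

  x+x≡0⇒x≡0 : ∀ x → x + x ≡ 0ℚ → x ≡ 0ℚ
  x+x≡0⇒x≡0 x x+x≡0 = *-zero-cancelˡ two x (λ ()) (trans (double x) x+x≡0)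
    where
    double : ∀ x → two * x ≡ x + x
    double = solve-∀ ℚ-ring

  sgnℕ-homo-+ : ∀ m n → sgnℕ (m ℕ.+ n) ≡ sgnℕ m * sgnℕ n
  sgnℕ-homo-+ zero    n = sym (*-identityˡ (sgnℕ n))
  sgnℕ-homo-+ (suc m) n = trans (cong -_ (sgnℕ-homo-+ m n)) (neg-distribˡ-* (sgnℕ m) (sgnℕ n))

  sgnℕ-*-sgnℕ : ∀ m → sgnℕ m * sgnℕ m ≡ 1ℚ
  sgnℕ-*-sgnℕ zero    = refl
  sgnℕ-*-sgnℕ (suc m) = trans (neg*neg (sgnℕ m)) (sgnℕ-*-sgnℕ m)
    where
    neg*neg : ∀ x → (- x) * (- x) ≡ x * x
    neg*neg = solve-∀ ℚ-ring

  sgnℕ-*-odd : ∀ x m → m % 2 ≡ 1 → sgnℕ (x ℕ.* m) ≡ sgnℕ x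
  sgnℕ-*-odd x m odd = begin
    sgnℕ (x ℕ.* m)                   ≡⟨ cong (λ k → sgnℕ (x ℕ.* k)) (trans (m≡m%n+[m/n]*n m 2) (cong (ℕ._+ h ℕ.* 2) odd)) ⟩
    sgnℕ (x ℕ.* (1 ℕ.+ h ℕ.* 2))     ≡⟨ cong sgnℕ (expand x h) ⟩
    sgnℕ (x ℕ.+ (x ℕ.* h ℕ.+ x ℕ.* h)) ≡⟨ sgnℕ-homo-+ x (x ℕ.* h ℕ.+ x ℕ.* h) ⟩
    sgnℕ x * sgnℕ (x ℕ.* h ℕ.+ x ℕ.* h) ≡⟨ cong (sgnℕ x *_) (trans (sgnℕ-homo-+ (x ℕ.* h) (x ℕ.* h)) (sgnℕ-*-sgnℕ (x ℕ.* h))) ⟩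
    sgnℕ x * 1ℚ                      ≡⟨ *-identityʳ (sgnℕ x) ⟩
    sgnℕ x                           ∎
    where
    h = m / 2
    expand : ∀ x h → x ℕ.* (1 ℕ.+ h ℕ.* 2) ≡ x ℕ.+ (x ℕ.* h ℕ.+ x ℕ.* h)
    expand = ℕ-Solver.solve-∀

  sgnℕ-odd : ∀ m → m % 2 ≡ 1 → sgnℕ m ≡ - 1ℚ
  sgnℕ-odd m odd = trans (cong sgnℕ (sym (ℕ.*-identityˡ m))) (sgnℕ-*-odd 1 m odd)

  sgnℕ-*-/-parity : ∀ j a b .{{_ : NonZero b}} → a % 2 ≡ 1 → b % 2 ≡ 1 → sgnℕ j * sgnℕ ((j ℕ.* a) / b) ≡ sgnℕ ((j ℕ.* a) % b)
  sgnℕ-*-/-parity j a b a-odd b-odd = begin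
    sgnℕ j * s                             ≡⟨ cong (_* s) (sym (sgnℕ-*-odd j a a-odd)) ⟩
    sgnℕ (j ℕ.* a) * s                     ≡⟨ cong (λ z → sgnℕ z * s) (m≡m%n+[m/n]*n (j ℕ.* a) b) ⟩
    sgnℕ (r ℕ.+ q ℕ.* b) * s               ≡⟨ cong (_* s) (trans (sgnℕ-homo-+ r (q ℕ.* b)) (cong (sgnℕ r *_) (sgnℕ-*-odd q b b-odd))) ⟩
    sgnℕ r * s * s                         ≡⟨ *-assoc (sgnℕ r) s s ⟩
    sgnℕ r * (s * s)                       ≡⟨ cong (sgnℕ r *_) (sgnℕ-*-sgnℕ q) ⟩
    sgnℕ r * 1ℚ                            ≡⟨ *-identityʳ (sgnℕ r) ⟩
    sgnℕ r                                 ∎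
    where
    q = (j ℕ.* a) / b
    r = (j ℕ.* a) % b
    s = sgnℕ q

  ^ℚ-distribʳ-* : ∀ x y n → (x * y) ^ℚ n ≡ x ^ℚ n * y ^ℚ n
  ^ℚ-distribʳ-* x y zero    = refl
  ^ℚ-distribʳ-* x y (suc n) = trans (cong (x * y *_) (^ℚ-distribʳ-* x y n)) (regroup x y (x ^ℚ n) (y ^ℚ n))
    where
    regroup : ∀ a b c d → a * b * (c * d) ≡ a * c * (b * d)
    regroup = solve-∀ ℚ-ring

  0^suc : ∀ n → 0ℚ ^ℚ suc n ≡ 0ℚ
  0^suc n = *-zeroˡ (0ℚ ^ℚ n)

  1^ : ∀ n → 1ℚ ^ℚ n ≡ 1ℚ
  1^ zero    = refl
  1^ (suc n) = trans (*-identityˡ (1ℚ ^ℚ n)) (1^ n)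

  divMod-unique : ∀ n q r b .{{_ : NonZero b}} → r ℕ.< b → n ≡ r ℕ.+ q ℕ.* b → n / b ≡ q × n % b ≡ r
  divMod-unique n q r b r<b n≡r+qb = sym q≡n/b , n%b≡r
    where
    n%b≡r : n % b ≡ r
    n%b≡r = trans (cong (_% b) n≡r+qb) (trans ([m+kn]%n≡m%n r q b) (m<n⇒m%n≡m r<b))
    q≡n/b : q ≡ n / b
    q≡n/b = ℕ.*-cancelʳ-≡ q (n / b) b (ℕ.+-cancelˡ-≡ r (q ℕ.* b) (n / b ℕ.* b)
              (trans (sym n≡r+qb) (trans (m≡m%n+[m/n]*n n b) (cong (ℕ._+ n / b ℕ.* b) n%b≡r))))

  m<[1+m/n]*n : ∀ m n .{{_ : NonZero n}} → m ℕ.< suc (m / n) ℕ.* n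
  m<[1+m/n]*n m n = subst (ℕ._< n ℕ.+ m / n ℕ.* n) (sym (m≡m%n+[m/n]*n m n)) (ℕ.+-monoˡ-< (m / n ℕ.* n) (m%n<n m n))

module Summation where

  open import Data.Nat as ℕ using (ℕ; zero; suc; s≤s; z≤n)
  import Data.Nat.Properties as ℕ
  open import Data.Rational using (ℚ; 0ℚ; 1ℚ; _+_; _*_; _-_; -_)
  open import Data.Rational.Properties
  open import Relation.Binary.PropositionalEquality
  open import Tactic.RingSolver using (solve-∀)
  open import Defs using (sgnℕ)
  open import Data.Nat.DivMod using (_/_)
  open import Data.Product using (proj₁)
  open Arithmetic using (ℚ-ring; two; divMod-unique)
  open ≡-Reasoning

  ∑ : ℕ → (ℕ → ℚ) → ℚ
  ∑ zero    f = 0ℚ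
  ∑ (suc n) f = f 0 + ∑ n (λ i → f (suc i))

  ∑-cong-< : ∀ n {f g : ℕ → ℚ} → (∀ i → i ℕ.< n → f i ≡ g i) → ∑ n f ≡ ∑ n g
  ∑-cong-< zero    f≡g = refl
  ∑-cong-< (suc n) f≡g = cong₂ _+_ (f≡g 0 (s≤s z≤n)) (∑-cong-< n (λ i i<n → f≡g (suc i) (s≤s i<n)))

  ∑-cong : ∀ n {f g : ℕ → ℚ} → (∀ i → f i ≡ g i) → ∑ n f ≡ ∑ n g
  ∑-cong n f≡g = ∑-cong-< n (λ i _ → f≡g i)

  ∑-zero : ∀ n → ∑ n (λ _ → 0ℚ) ≡ 0ℚ
  ∑-zero zero    = refl
  ∑-zero (suc n) = trans (+-identityˡ _) (∑-zero n)

  ∑-init-last : ∀ n f → ∑ (suc n) f ≡ ∑ n f + f n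
  ∑-init-last zero    f = trans (+-identityʳ (f 0)) (sym (+-identityˡ (f 0)))
  ∑-init-last (suc n) f = begin
    f 0 + ∑ (suc n) (λ i → f (suc i))             ≡⟨ cong (f 0 +_) (∑-init-last n (λ i → f (suc i))) ⟩
    f 0 + (∑ n (λ i → f (suc i)) + f (suc n))     ≡⟨ sym (+-assoc (f 0) _ _) ⟩
    ∑ (suc n) f + f (suc n)                       ∎

  ∑-distrib-+ : ∀ n f g → ∑ n (λ i → f i + g i) ≡ ∑ n f + ∑ n g
  ∑-distrib-+ zero    f g = refl
  ∑-distrib-+ (suc n) f g = trans (cong (f 0 + g 0 +_) (∑-distrib-+ n (λ i → f (suc i)) (λ i → g (suc i))))
                                  (interchange (f 0) (g 0) _ _)
    where
    interchange : ∀ a b c d → a + b + (c + d) ≡ a + c + (b + d)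
    interchange = solve-∀ ℚ-ring

  *-distribˡ-∑ : ∀ n c f → c * ∑ n f ≡ ∑ n (λ i → c * f i)
  *-distribˡ-∑ zero    c f = *-zeroʳ c
  *-distribˡ-∑ (suc n) c f = trans (*-distribˡ-+ c (f 0) _) (cong (c * f 0 +_) (*-distribˡ-∑ n c (λ i → f (suc i))))

  ∑-neg : ∀ n f → ∑ n (λ i → - f i) ≡ - ∑ n f
  ∑-neg zero    f = refl
  ∑-neg (suc n) f = trans (cong (- f 0 +_) (∑-neg n (λ i → f (suc i)))) (sym (neg-distrib-+ (f 0) _))

  ∑-+ : ∀ m n f → ∑ (m ℕ.+ n) f ≡ ∑ m f + ∑ n (λ i → f (m ℕ.+ i))
  ∑-+ zero    n f = sym (+-identityˡ _)
  ∑-+ (suc m) n f = trans (cong (f 0 +_) (∑-+ m n (λ i → f (suc i)))) (sym (+-assoc (f 0) _ _))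

  ∑-* : ∀ m k f → ∑ (m ℕ.* k) f ≡ ∑ m (λ j → ∑ k (λ r → f (j ℕ.* k ℕ.+ r)))
  ∑-* zero    k f = refl
  ∑-* (suc m) k f = begin
    ∑ (k ℕ.+ m ℕ.* k) f                                          ≡⟨ ∑-+ k (m ℕ.* k) f ⟩
    ∑ k f + ∑ (m ℕ.* k) (λ i → f (k ℕ.+ i))                       ≡⟨ cong (∑ k f +_) (∑-* m k (λ i → f (k ℕ.+ i))) ⟩
    ∑ k f + ∑ m (λ j → ∑ k (λ r → f (k ℕ.+ (j ℕ.* k ℕ.+ r))))
      ≡⟨ cong (∑ k f +_) (∑-cong m (λ j → ∑-cong k (λ r → cong f (sym (ℕ.+-assoc k (j ℕ.* k) r))))) ⟩
    ∑ k f + ∑ m (λ j → ∑ k (λ r → f (suc j ℕ.* k ℕ.+ r)))         ∎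

  ∑-telescope : ∀ n (g : ℕ → ℚ) → ∑ n (λ i → g (suc i) - g i) ≡ g n - g 0
  ∑-telescope zero    g = sym (+-inverseʳ (g 0))
  ∑-telescope (suc n) g = begin
    ∑ (suc n) (λ i → g (suc i) - g i)                  ≡⟨ ∑-init-last n (λ i → g (suc i) - g i) ⟩
    ∑ n (λ i → g (suc i) - g i) + (g (suc n) - g n)    ≡⟨ cong (_+ (g (suc n) - g n)) (∑-telescope n g) ⟩
    g n - g 0 + (g (suc n) - g n)                      ≡⟨ cancel (g n) (g 0) (g (suc n)) ⟩
    g (suc n) - g 0                                    ∎
    where
    cancel : ∀ a b c → a - b + (c - a) ≡ c - b
    cancel = solve-∀ ℚ-ring

  ∑-alternating-telescope : ∀ n (v : ℕ → ℚ) →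
    ∑ n (λ j → sgnℕ j * (v (suc j) - v j)) ≡ v 0 - sgnℕ n * v n - two * ∑ n (λ j → sgnℕ j * v j)
  ∑-alternating-telescope zero    v = cancel (v 0)
    where
    cancel : ∀ x → 0ℚ ≡ x - 1ℚ * x - (1ℚ + 1ℚ) * 0ℚ
    cancel = solve-∀ ℚ-ring
  ∑-alternating-telescope (suc n) v = begin
    ∑ (suc n) (λ j → sgnℕ j * (v (suc j) - v j))
      ≡⟨ ∑-init-last n (λ j → sgnℕ j * (v (suc j) - v j)) ⟩
    ∑ n (λ j → sgnℕ j * (v (suc j) - v j)) + sgnℕ n * (v (suc n) - v n)
      ≡⟨ cong (_+ sgnℕ n * (v (suc n) - v n)) (∑-alternating-telescope n v) ⟩
    v 0 - sgnℕ n * v n - two * S + sgnℕ n * (v (suc n) - v n)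
      ≡⟨ regroup (v 0) (sgnℕ n) (v n) S (v (suc n)) ⟩
    v 0 - (- sgnℕ n) * v (suc n) - two * (S + sgnℕ n * v n)
      ≡⟨ cong (λ z → v 0 - (- sgnℕ n) * v (suc n) - two * z) (sym (∑-init-last n (λ j → sgnℕ j * v j))) ⟩
    v 0 - sgnℕ (suc n) * v (suc n) - two * ∑ (suc n) (λ j → sgnℕ j * v j) ∎
    where
    S = ∑ n (λ j → sgnℕ j * v j)
    regroup : ∀ v₀ s vₙ S v₁ → v₀ - s * vₙ - (1ℚ + 1ℚ) * S + s * (v₁ - vₙ) ≡ v₀ - (- s) * v₁ - (1ℚ + 1ℚ) * (S + s * vₙ)
    regroup = solve-∀ ℚ-ring

  ∑-block-telescope : ∀ (s w : ℕ → ℚ) k j →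
    ∑ (suc k) (λ r → s ((j ℕ.* suc k ℕ.+ r) / suc k) * (w (suc (j ℕ.* suc k ℕ.+ r)) - w (j ℕ.* suc k ℕ.+ r))) ≡
    s j * (w (suc j ℕ.* suc k) - w (j ℕ.* suc k))
  ∑-block-telescope s w k j = begin
    ∑ (suc k) (λ r → s ((jK ℕ.+ r) / suc k) * (w (suc (jK ℕ.+ r)) - w (jK ℕ.+ r)))
      ≡⟨ ∑-cong-< (suc k) (λ r r<K → cong₂ (λ q z → s q * (w z - w (jK ℕ.+ r)))
           (proj₁ (divMod-unique (jK ℕ.+ r) j r (suc k) r<K (ℕ.+-comm jK r))) (sym (ℕ.+-suc jK r))) ⟩
    ∑ (suc k) (λ r → s j * (g (suc r) - g r))
      ≡⟨ sym (*-distribˡ-∑ (suc k) (s j) (λ r → g (suc r) - g r)) ⟩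
    s j * ∑ (suc k) (λ r → g (suc r) - g r)
      ≡⟨ cong (s j *_) (∑-telescope (suc k) g) ⟩
    s j * (g (suc k) - g 0)
      ≡⟨ cong₂ (λ y z → s j * (w y - w z)) (ℕ.+-comm jK (suc k)) (ℕ.+-identityʳ jK) ⟩
    s j * (w (suc j ℕ.* suc k) - w jK)
      ∎
    where
    jK = j ℕ.* suc k
    g : ℕ → ℚ
    g r = w (jK ℕ.+ r)

module Polynomial where

  open import Data.Nat using (ℕ; zero; suc)
  open import Data.Rational using (ℚ; 0ℚ; 1ℚ; _+_; _*_; _-_; -_)
  open import Data.Rational.Properties
  open import Data.List using ([]; _∷_)
  open import Data.Product using (Σ; _,_; proj₁)
  open import Relation.Binary.PropositionalEquality
  open import Tactic.RingSolver using (solve-∀)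
  open import Defs
  open Arithmetic
  open Summation using (∑)
  open ≡-Reasoning

  _-ₚ_ : Poly → Poly → Poly
  p -ₚ q = p +ₚ scaleₚ (- 1ℚ) q

  _*ₚ_ : Poly → Poly → Poly
  []       *ₚ q = []
  (c ∷ cs) *ₚ q = scaleₚ c q +ₚ (0ℚ ∷ (cs *ₚ q))

  lin : ℚ → ℚ → Poly
  lin u v = v ∷ u ∷ []

  comp : Poly → Poly → Poly
  comp []       L = []
  comp (c ∷ cs) L = (c ∷ []) +ₚ (L *ₚ comp cs L)

  Σₚ : ℕ → (ℕ → Poly) → Poly
  Σₚ zero    f = []
  Σₚ (suc n) f = f 0 +ₚ Σₚ n (λ i → f (suc i))

  weighted : ℕ → Poly → Poly
  weighted i []       = []
  weighted i (c ∷ cs) = ℕ→ℚ i * c ∷ weighted (suc i) cs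

  deriv : Poly → Poly
  deriv []       = []
  deriv (c ∷ cs) = weighted 1 cs

  eval-+ₚ : ∀ p q x → eval (p +ₚ q) x ≡ eval p x + eval q x
  eval-+ₚ []       q        x = sym (+-identityˡ _)
  eval-+ₚ (c ∷ cs) []       x = sym (+-identityʳ _)
  eval-+ₚ (c ∷ cs) (d ∷ ds) x = begin
    c + d + x * eval (cs +ₚ ds) x              ≡⟨ cong (λ t → c + d + x * t) (eval-+ₚ cs ds x) ⟩
    c + d + x * (eval cs x + eval ds x)        ≡⟨ regroup c d x (eval cs x) (eval ds x) ⟩
    c + x * eval cs x + (d + x * eval ds x)    ∎
    where
    regroup : ∀ c d x a b → c + d + x * (a + b) ≡ c + x * a + (d + x * b)
    regroup = solve-∀ ℚ-ring

  eval-scaleₚ : ∀ r p x → eval (scaleₚ r p) x ≡ r * eval p x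
  eval-scaleₚ r []       x = sym (*-zeroʳ r)
  eval-scaleₚ r (c ∷ cs) x = begin
    r * c + x * eval (scaleₚ r cs) x    ≡⟨ cong (λ t → r * c + x * t) (eval-scaleₚ r cs x) ⟩
    r * c + x * (r * eval cs x)         ≡⟨ regroup r c x (eval cs x) ⟩
    r * (c + x * eval cs x)             ∎
    where
    regroup : ∀ r c x a → r * c + x * (r * a) ≡ r * (c + x * a)
    regroup = solve-∀ ℚ-ring

  eval-subₚ : ∀ p q x → eval (p -ₚ q) x ≡ eval p x - eval q x
  eval-subₚ p q x = trans (eval-+ₚ p (scaleₚ (- 1ℚ) q) x)
                        (cong (eval p x +_) (trans (eval-scaleₚ (- 1ℚ) q x) (-1*x≡-x (eval q x))))
    where
    -1*x≡-x : ∀ x → (- 1ℚ) * x ≡ - x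
    -1*x≡-x = solve-∀ ℚ-ring

  eval-const : ∀ c x → eval (c ∷ []) x ≡ c
  eval-const c x = trans (cong (c +_) (*-zeroʳ x)) (+-identityʳ c)

  eval-at-0 : ∀ c cs → eval (c ∷ cs) 0ℚ ≡ c
  eval-at-0 c cs = trans (cong (c +_) (*-zeroˡ (eval cs 0ℚ))) (+-identityʳ c)

  eval-monoₚ : ∀ k x → eval (monoₚ k) x ≡ x ^ℚ k
  eval-monoₚ zero    x = eval-const 1ℚ x
  eval-monoₚ (suc k) x = trans (+-identityˡ _) (cong (x *_) (eval-monoₚ k x))

  eval-*ₚ : ∀ p q x → eval (p *ₚ q) x ≡ eval p x * eval q x
  eval-*ₚ []       q x = sym (*-zeroˡ (eval q x))
  eval-*ₚ (c ∷ cs) q x = begin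
    eval (scaleₚ c q +ₚ (0ℚ ∷ (cs *ₚ q))) x              ≡⟨ eval-+ₚ (scaleₚ c q) _ x ⟩
    eval (scaleₚ c q) x + (0ℚ + x * eval (cs *ₚ q) x)  ≡⟨ cong₂ (λ a b → a + (0ℚ + x * b)) (eval-scaleₚ c q x) (eval-*ₚ cs q x) ⟩
    c * eval q x + (0ℚ + x * (eval cs x * eval q x))   ≡⟨ regroup c (eval q x) x (eval cs x) ⟩
    (c + x * eval cs x) * eval q x                     ∎
    where
    regroup : ∀ c q x a → c * q + (0ℚ + x * (a * q)) ≡ (c + x * a) * q
    regroup = solve-∀ ℚ-ring

  eval-lin : ∀ u v x → eval (lin u v) x ≡ u * x + v
  eval-lin u v x = simplify u v x
    where
    simplify : ∀ u v x → v + x * (u + x * 0ℚ) ≡ u * x + v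
    simplify = solve-∀ ℚ-ring

  eval-comp : ∀ p L x → eval (comp p L) x ≡ eval p (eval L x)
  eval-comp []       L x = refl
  eval-comp (c ∷ cs) L x = begin
    eval ((c ∷ []) +ₚ (L *ₚ comp cs L)) x           ≡⟨ eval-+ₚ (c ∷ []) (L *ₚ comp cs L) x ⟩
    eval (c ∷ []) x + eval (L *ₚ comp cs L) x     ≡⟨ cong₂ _+_ (eval-const c x) (eval-*ₚ L (comp cs L) x) ⟩
    c + eval L x * eval (comp cs L) x             ≡⟨ cong (λ t → c + eval L x * t) (eval-comp cs L x) ⟩
    c + eval L x * eval cs (eval L x)             ∎

  eval-Σₚ : ∀ n f x → eval (Σₚ n f) x ≡ ∑ n (λ i → eval (f i) x)
  eval-Σₚ zero    f x = refl
  eval-Σₚ (suc n) f x = trans (eval-+ₚ (f 0) _ x) (cong (eval (f 0) x +_) (eval-Σₚ n (λ i → f (suc i)) x))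

  weighted-+ₚ : ∀ i p q → weighted i (p +ₚ q) ≡ weighted i p +ₚ weighted i q
  weighted-+ₚ i []       q        = refl
  weighted-+ₚ i (c ∷ cs) []       = refl
  weighted-+ₚ i (c ∷ cs) (d ∷ ds) = cong₂ _∷_ (*-distribˡ-+ (ℕ→ℚ i) c d) (weighted-+ₚ (suc i) cs ds)

  deriv-+ₚ : ∀ p q → deriv (p +ₚ q) ≡ deriv p +ₚ deriv q
  deriv-+ₚ []       q        = refl
  deriv-+ₚ (c ∷ cs) []       with weighted 1 cs
  ... | []     = refl
  ... | _ ∷ _  = refl
  deriv-+ₚ (c ∷ cs) (d ∷ ds) = weighted-+ₚ 1 cs ds

  weighted-scaleₚ : ∀ i r p → weighted i (scaleₚ r p) ≡ scaleₚ r (weighted i p)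
  weighted-scaleₚ i r []       = refl
  weighted-scaleₚ i r (c ∷ cs) = cong₂ _∷_ (commute (ℕ→ℚ i) r c) (weighted-scaleₚ (suc i) r cs)
    where
    commute : ∀ a r c → a * (r * c) ≡ r * (a * c)
    commute = solve-∀ ℚ-ring

  deriv-scaleₚ : ∀ r p → deriv (scaleₚ r p) ≡ scaleₚ r (deriv p)
  deriv-scaleₚ r []       = refl
  deriv-scaleₚ r (c ∷ cs) = weighted-scaleₚ 1 r cs

  eval-weighted : ∀ i p x → eval (weighted i p) x ≡ ℕ→ℚ i * eval p x + x * eval (deriv p) x
  eval-weighted i []       x = sym (trans (cong₂ _+_ (*-zeroʳ (ℕ→ℚ i)) (*-zeroʳ x)) (+-identityˡ 0ℚ))
  eval-weighted i (c ∷ cs) x = begin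
    ℕ→ℚ i * c + x * eval (weighted (suc i) cs) x
      ≡⟨ cong (λ t → ℕ→ℚ i * c + x * t) (eval-weighted (suc i) cs x) ⟩
    ℕ→ℚ i * c + x * (ℕ→ℚ (suc i) * eval cs x + x * eval (deriv cs) x)
      ≡⟨ cong (λ t → ℕ→ℚ i * c + x * (t * eval cs x + x * eval (deriv cs) x)) (ℕ→ℚ-suc i) ⟩
    ℕ→ℚ i * c + x * ((1ℚ + ℕ→ℚ i) * eval cs x + x * eval (deriv cs) x)
      ≡⟨ regroup (ℕ→ℚ i) c x (eval cs x) (eval (deriv cs) x) ⟩
    ℕ→ℚ i * (c + x * eval cs x) + x * (1ℚ * eval cs x + x * eval (deriv cs) x)
      ≡⟨ cong (λ t → ℕ→ℚ i * (c + x * eval cs x) + x * t) (sym (eval-weighted 1 cs x)) ⟩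
    ℕ→ℚ i * (c + x * eval cs x) + x * eval (weighted 1 cs) x
      ∎
    where
    regroup : ∀ a c x e d → a * c + x * ((1ℚ + a) * e + x * d) ≡ a * (c + x * e) + x * (1ℚ * e + x * d)
    regroup = solve-∀ ℚ-ring

  eval-deriv-∷ : ∀ c cs x → eval (deriv (c ∷ cs)) x ≡ eval cs x + x * eval (deriv cs) x
  eval-deriv-∷ c cs x = trans (eval-weighted 1 cs x) (cong (_+ x * eval (deriv cs) x) (*-identityˡ (eval cs x)))

  eval-deriv-+ₚ : ∀ p q x → eval (deriv (p +ₚ q)) x ≡ eval (deriv p) x + eval (deriv q) x
  eval-deriv-+ₚ p q x = trans (cong (λ t → eval t x) (deriv-+ₚ p q)) (eval-+ₚ (deriv p) (deriv q) x)

  eval-deriv-scaleₚ : ∀ r p x → eval (deriv (scaleₚ r p)) x ≡ r * eval (deriv p) x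
  eval-deriv-scaleₚ r p x = trans (cong (λ t → eval t x) (deriv-scaleₚ r p)) (eval-scaleₚ r (deriv p) x)

  eval-deriv-subₚ : ∀ p q x → eval (deriv (p -ₚ q)) x ≡ eval (deriv p) x - eval (deriv q) x
  eval-deriv-subₚ p q x = begin
    eval (deriv (p -ₚ q)) x                                    ≡⟨ eval-deriv-+ₚ p (scaleₚ (- 1ℚ) q) x ⟩
    eval (deriv p) x + eval (deriv (scaleₚ (- 1ℚ) q)) x         ≡⟨ cong (eval (deriv p) x +_) (eval-deriv-scaleₚ (- 1ℚ) q x) ⟩
    eval (deriv p) x + (- 1ℚ) * eval (deriv q) x                ≡⟨ cong (eval (deriv p) x +_) (-1*x≡-x (eval (deriv q) x)) ⟩
    eval (deriv p) x - eval (deriv q) x                         ∎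
    where
    -1*x≡-x : ∀ x → (- 1ℚ) * x ≡ - x
    -1*x≡-x = solve-∀ ℚ-ring

  eval-deriv-*ₚ : ∀ p q x → eval (deriv (p *ₚ q)) x ≡ eval (deriv p) x * eval q x + eval p x * eval (deriv q) x
  eval-deriv-*ₚ []       q x = sym (trans (cong₂ _+_ (*-zeroˡ (eval q x)) (*-zeroˡ (eval (deriv q) x))) (+-identityˡ 0ℚ))
  eval-deriv-*ₚ (c ∷ cs) q x = begin
    eval (deriv (scaleₚ c q +ₚ (0ℚ ∷ (cs *ₚ q)))) x
      ≡⟨ eval-deriv-+ₚ (scaleₚ c q) _ x ⟩
    eval (deriv (scaleₚ c q)) x + eval (deriv (0ℚ ∷ (cs *ₚ q))) x
      ≡⟨ cong₂ _+_ (eval-deriv-scaleₚ c q x) (eval-deriv-∷ 0ℚ (cs *ₚ q) x) ⟩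
    c * q′ + (eval (cs *ₚ q) x + x * eval (deriv (cs *ₚ q)) x)
      ≡⟨ cong₂ (λ a b → c * q′ + (a + x * b)) (eval-*ₚ cs q x) (eval-deriv-*ₚ cs q x) ⟩
    c * q′ + (eval cs x * eval q x + x * (eval (deriv cs) x * eval q x + eval cs x * q′))
      ≡⟨ regroup c q′ (eval cs x) (eval q x) x (eval (deriv cs) x) ⟩
    (eval cs x + x * eval (deriv cs) x) * eval q x + (c + x * eval cs x) * q′
      ≡⟨ cong (λ t → t * eval q x + (c + x * eval cs x) * q′) (sym (eval-deriv-∷ c cs x)) ⟩
    eval (deriv (c ∷ cs)) x * eval q x + (c + x * eval cs x) * q′
      ∎
    where
    q′ = eval (deriv q) x
    regroup : ∀ c dq a q x da → c * dq + (a * q + x * (da * q + a * dq)) ≡ (a + x * da) * q + (c + x * a) * dq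
    regroup = solve-∀ ℚ-ring

  eval-deriv-comp : ∀ p L x → eval (deriv (comp p L)) x ≡ eval (deriv L) x * eval (deriv p) (eval L x)
  eval-deriv-comp []       L x = sym (*-zeroʳ (eval (deriv L) x))
  eval-deriv-comp (c ∷ cs) L x = begin
    eval (deriv ((c ∷ []) +ₚ (L *ₚ comp cs L))) x
      ≡⟨ eval-deriv-+ₚ (c ∷ []) (L *ₚ comp cs L) x ⟩
    0ℚ + eval (deriv (L *ₚ comp cs L)) x
      ≡⟨ cong (0ℚ +_) (eval-deriv-*ₚ L (comp cs L) x) ⟩
    0ℚ + (L′ * eval (comp cs L) x + y * eval (deriv (comp cs L)) x)
      ≡⟨ cong₂ (λ a b → 0ℚ + (L′ * a + y * b)) (eval-comp cs L x) (eval-deriv-comp cs L x) ⟩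
    0ℚ + (L′ * eval cs y + y * (L′ * eval (deriv cs) y))
      ≡⟨ regroup L′ (eval cs y) y (eval (deriv cs) y) ⟩
    L′ * (eval cs y + y * eval (deriv cs) y)
      ≡⟨ cong (L′ *_) (sym (eval-deriv-∷ c cs y)) ⟩
    L′ * eval (deriv (c ∷ cs)) y
      ∎
    where
    y  = eval L x
    L′ = eval (deriv L) x
    regroup : ∀ d a y e → 0ℚ + (d * a + y * (d * e)) ≡ d * (a + y * e)
    regroup = solve-∀ ℚ-ring

  eval-deriv-lin : ∀ u v x → eval (deriv (lin u v)) x ≡ u
  eval-deriv-lin u v x = trans (eval-const (1ℚ * u) x) (*-identityˡ u)

  eval-deriv-monoₚ : ∀ k x → eval (deriv (monoₚ (suc k))) x ≡ ℕ→ℚ (suc k) * x ^ℚ k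
  eval-deriv-monoₚ zero    x = trans (eval-deriv-∷ 0ℚ (1ℚ ∷ []) x) (simplify x)
    where
    simplify : ∀ x → 1ℚ + x * 0ℚ + x * 0ℚ ≡ 1ℚ * 1ℚ
    simplify = solve-∀ ℚ-ring
  eval-deriv-monoₚ (suc k) x = begin
    eval (deriv (0ℚ ∷ monoₚ (suc k))) x
      ≡⟨ eval-deriv-∷ 0ℚ (monoₚ (suc k)) x ⟩
    eval (monoₚ (suc k)) x + x * eval (deriv (monoₚ (suc k))) x
      ≡⟨ cong₂ (λ a b → a + x * b) (eval-monoₚ (suc k) x) (eval-deriv-monoₚ k x) ⟩
    x * x ^ℚ k + x * (ℕ→ℚ (suc k) * x ^ℚ k)
      ≡⟨ regroup x (x ^ℚ k) (ℕ→ℚ (suc k)) ⟩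
    (1ℚ + ℕ→ℚ (suc k)) * (x * x ^ℚ k)
      ≡⟨ cong (_* (x * x ^ℚ k)) (sym (ℕ→ℚ-suc (suc k))) ⟩
    ℕ→ℚ (suc (suc k)) * (x * x ^ℚ k)
      ∎
    where
    regroup : ∀ x p n → x * p + x * (n * p) ≡ (1ℚ + n) * (x * p)
    regroup = solve-∀ ℚ-ring

  -- antideriv is built from a helper that Defs keeps private. Abstracting
  -- the literals in its one visible call turns the defining equation into a
  -- pattern-unification problem, whose solution names that helper.
  private
    antiderivFrom-exists : Σ (ℕ → Poly → Poly) λ F → ∀ p → antideriv p ≡ 0ℚ ∷ F 0 p
    antiderivFrom-exists = F , unfold
      where
      F : ℕ → Poly → Poly
      F = _
      unfold : ∀ p → antideriv p ≡ 0ℚ ∷ F 0 p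
      unfold p with 0 | 0ℚ
      ... | _ | _ = refl

    antiderivFrom : ℕ → Poly → Poly
    antiderivFrom = proj₁ antiderivFrom-exists

    weighted-antiderivFrom : ∀ i p → weighted (suc i) (antiderivFrom i p) ≡ p
    weighted-antiderivFrom i []       = refl
    weighted-antiderivFrom i (c ∷ cs) = cong₂ _∷_ cancel (weighted-antiderivFrom (suc i) cs)
      where
      cancel : ℕ→ℚ (suc i) * (recip (suc i) * c) ≡ c
      cancel = trans (sym (*-assoc (ℕ→ℚ (suc i)) _ c)) (trans (cong (_* c) (recip-inverseʳ i)) (*-identityˡ c))

  deriv-antideriv : ∀ p → deriv (antideriv p) ≡ p
  deriv-antideriv = weighted-antiderivFrom 0

  eval-antideriv-0 : ∀ p → eval (antideriv p) 0ℚ ≡ 0ℚ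
  eval-antideriv-0 p = eval-at-0 0ℚ (antiderivFrom 0 p)

module PolynomialFunction where

  open import Data.Nat as ℕ using (ℕ; zero; suc)
  import Data.Nat.Properties as ℕ
  open import Data.Rational as ℚ using (ℚ; 0ℚ; 1ℚ; _+_; _*_; _-_; -_; _<_)
  open import Data.Rational.Properties
  open import Data.List using ([]; _∷_; length)
  open import Data.List.Relation.Unary.All using (All; []; _∷_)
  open import Function.Definitions using (Injective)
  open import Relation.Binary.PropositionalEquality
  open import Tactic.RingSolver using (solve-∀)
  open import Defs
  open Arithmetic
  open Polynomial
  open ≡-Reasoning

  private
    -- synthetic division by x - r
    quotient : ℚ → Poly → Poly
    quotient r []           = []
    quotient r (c ∷ [])     = []
    quotient r (c ∷ d ∷ ds) = eval (d ∷ ds) r ∷ quotient r (d ∷ ds)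

    length-quotient : ∀ r c cs → length (quotient r (c ∷ cs)) ≡ length cs
    length-quotient r c []       = refl
    length-quotient r c (d ∷ ds) = cong suc (length-quotient r d ds)

    eval-quotient : ∀ r c cs x → eval (c ∷ cs) x ≡ eval (c ∷ cs) r + (x - r) * eval (quotient r (c ∷ cs)) x
    eval-quotient r c []       x = simplify c r x
      where
      simplify : ∀ c r x → c + x * 0ℚ ≡ c + r * 0ℚ + (x - r) * 0ℚ
      simplify = solve-∀ ℚ-ring
    eval-quotient r c (d ∷ ds) x = begin
      c + x * eval (d ∷ ds) x          ≡⟨ cong (λ t → c + x * t) (eval-quotient r d ds x) ⟩
      c + x * (P + (x - r) * Q)        ≡⟨ regroup c x P r Q ⟩
      c + r * P + (x - r) * (P + x * Q) ∎
      where
      P = eval (d ∷ ds) r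
      Q = eval (quotient r (d ∷ ds)) x
      regroup : ∀ c x P r Q → c + x * (P + (x - r) * Q) ≡ c + r * P + (x - r) * (P + x * Q)
      regroup = solve-∀ ℚ-ring

    -- the length index is the termination measure: quotient shortens p by one
    vanishing-by-length : ∀ n p → length p ≡ n → (g : ℕ → ℚ) → Injective _≡_ _≡_ g →
                          (∀ j → eval p (g j) ≡ 0ℚ) → ∀ x → eval p x ≡ 0ℚ
    vanishing-by-length n       []       _   g g-inj p[g]≡0 x = refl
    vanishing-by-length zero    (c ∷ cs) ()  g g-inj p[g]≡0 x
    vanishing-by-length (suc n) (c ∷ cs) len g g-inj p[g]≡0 x = begin
      eval (c ∷ cs) x                            ≡⟨ eval-quotient r c cs x ⟩
      eval (c ∷ cs) r + (x - r) * eval q x       ≡⟨ cong₂ (λ a b → a + (x - r) * b) (p[g]≡0 0) (q≡0 x) ⟩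
      0ℚ + (x - r) * 0ℚ                          ≡⟨ cong (0ℚ +_) (*-zeroʳ (x - r)) ⟩
      0ℚ + 0ℚ                                    ≡⟨ +-identityˡ 0ℚ ⟩
      0ℚ                                         ∎
      where
      r = g 0
      q = quotient r (c ∷ cs)
      q[g∘suc]≡0 : ∀ j → eval q (g (suc j)) ≡ 0ℚ
      q[g∘suc]≡0 j = *-zero-cancelˡ (g (suc j) - r) (eval q (g (suc j)))
        (λ eq → ℕ.1+n≢0 (g-inj (x-y≡0⇒x≡y (g (suc j)) r eq)))
        (begin
          (g (suc j) - r) * eval q (g (suc j))                     ≡⟨ sym (+-identityˡ _) ⟩
          0ℚ + (g (suc j) - r) * eval q (g (suc j))                ≡⟨ cong (_+ (g (suc j) - r) * eval q (g (suc j))) (sym (p[g]≡0 0)) ⟩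
          eval (c ∷ cs) r + (g (suc j) - r) * eval q (g (suc j))   ≡⟨ sym (eval-quotient r c cs (g (suc j))) ⟩
          eval (c ∷ cs) (g (suc j))                                ≡⟨ p[g]≡0 (suc j) ⟩
          0ℚ                                                       ∎)
      q≡0 : ∀ y → eval q y ≡ 0ℚ
      q≡0 = vanishing-by-length n q (trans (length-quotient r c cs) (ℕ.suc-injective len))
              (λ j → g (suc j)) (λ eq → ℕ.suc-injective (g-inj eq)) q[g∘suc]≡0

  vanishing-on-injective⇒≡0 : ∀ p (g : ℕ → ℚ) → Injective _≡_ _≡_ g →
                             (∀ j → eval p (g j) ≡ 0ℚ) → ∀ x → eval p x ≡ 0ℚ
  vanishing-on-injective⇒≡0 p = vanishing-by-length (length p) p refl

  All≡0⇒eval≡0 : ∀ {p} → All (_≡ 0ℚ) p → ∀ x → eval p x ≡ 0ℚ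
  All≡0⇒eval≡0 []             x = refl
  All≡0⇒eval≡0 {c ∷ cs} (c≡0 ∷ cs≡0) x = begin
    c + x * eval cs x ≡⟨ cong₂ (λ a t → a + x * t) c≡0 (All≡0⇒eval≡0 cs≡0 x) ⟩
    0ℚ + x * 0ℚ      ≡⟨ cong (0ℚ +_) (*-zeroʳ x) ⟩
    0ℚ + 0ℚ          ≡⟨ +-identityˡ 0ℚ ⟩
    0ℚ               ∎

  eval≡0⇒All≡0 : ∀ p → (∀ x → eval p x ≡ 0ℚ) → All (_≡ 0ℚ) p
  eval≡0⇒All≡0 []       p≡0 = []
  eval≡0⇒All≡0 (c ∷ cs) p≡0 = c≡0 ∷ eval≡0⇒All≡0 cs cs≡0
    where
    c≡0 : c ≡ 0ℚ
    c≡0 = trans (sym (eval-at-0 c cs)) (p≡0 0ℚ)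
    -- as c = 0, p x = x · cs(x), so cs vanishes at 1, 2, 3, ...
    cs[1+j]≡0 : ∀ j → eval cs (ℕ→ℚ (suc j)) ≡ 0ℚ
    cs[1+j]≡0 j = *-zero-cancelˡ (ℕ→ℚ (suc j)) _ (ℕ→ℚ-suc≢0 j)
      (trans (sym (+-identityˡ _)) (trans (cong (_+ _) (sym c≡0)) (p≡0 (ℕ→ℚ (suc j)))))
    cs≡0 : ∀ x → eval cs x ≡ 0ℚ
    cs≡0 = vanishing-on-injective⇒≡0 cs (λ j → ℕ→ℚ (suc j)) (λ eq → ℕ.suc-injective (ℕ→ℚ-injective eq)) cs[1+j]≡0

  private
    weighted-All≡0 : ∀ i p → All (_≡ 0ℚ) (weighted (suc i) p) → All (_≡ 0ℚ) p
    weighted-All≡0 i []       []                 = []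
    weighted-All≡0 i (c ∷ cs) (ic≡0 ∷ cs′≡0) =
      *-zero-cancelˡ (ℕ→ℚ (suc i)) c (ℕ→ℚ-suc≢0 i) ic≡0 ∷ weighted-All≡0 (suc i) cs cs′≡0

  deriv≡0⇒constant : ∀ p → (∀ x → eval (deriv p) x ≡ 0ℚ) → ∀ x → eval p x ≡ eval p 0ℚ
  deriv≡0⇒constant []       p′≡0 x = refl
  deriv≡0⇒constant (c ∷ cs) p′≡0 x = begin
    c + x * eval cs x     ≡⟨ cong (λ t → c + x * t) (All≡0⇒eval≡0 (weighted-All≡0 0 cs (eval≡0⇒All≡0 (weighted 1 cs) p′≡0)) x) ⟩
    c + x * 0ℚ            ≡⟨ trans (cong (c +_) (*-zeroʳ x)) (+-identityʳ c) ⟩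
    c                     ≡⟨ sym (eval-at-0 c cs) ⟩
    eval (c ∷ cs) 0ℚ      ∎

  same-deriv⇒same-increment : ∀ p q → (∀ x → eval (deriv p) x ≡ eval (deriv q) x) →
                              ∀ x → eval p x - eval p 0ℚ ≡ eval q x - eval q 0ℚ
  same-deriv⇒same-increment p q p′≡q′ x = begin
    eval p x - eval p 0ℚ
      ≡⟨ regroup (eval p x) (eval p 0ℚ) (eval q x) (eval q 0ℚ) ⟩
    (eval p x - eval q x) - (eval p 0ℚ - eval q 0ℚ) + (eval q x - eval q 0ℚ)
      ≡⟨ cong₂ (λ a b → a - b + (eval q x - eval q 0ℚ)) (sym (eval-subₚ p q x)) (sym (eval-subₚ p q 0ℚ)) ⟩
    eval d x - eval d 0ℚ + (eval q x - eval q 0ℚ)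
      ≡⟨ cong (λ t → t - eval d 0ℚ + (eval q x - eval q 0ℚ)) (deriv≡0⇒constant d d′≡0 x) ⟩
    eval d 0ℚ - eval d 0ℚ + (eval q x - eval q 0ℚ)
      ≡⟨ cong (_+ (eval q x - eval q 0ℚ)) (+-inverseʳ (eval d 0ℚ)) ⟩
    0ℚ + (eval q x - eval q 0ℚ)
      ≡⟨ +-identityˡ _ ⟩
    eval q x - eval q 0ℚ
      ∎
    where
    d = p -ₚ q
    d′≡0 : ∀ x → eval (deriv d) x ≡ 0ℚ
    d′≡0 x = trans (eval-deriv-subₚ p q x) (trans (cong (_- eval (deriv q) x) (p′≡q′ x)) (+-inverseʳ (eval (deriv q) x)))
    regroup : ∀ a b c d → a - b ≡ (a - c) - (b - d) + (c - d)
    regroup = solve-∀ ℚ-ring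

  fundamental-theorem : ∀ G h → (∀ x → eval (deriv G) x ≡ eval h x) → ∀ l u → ∫poly h l u ≡ eval G u - eval G l
  fundamental-theorem G h G′≡h l u = begin
    eval A u - eval A l                                   ≡⟨ cong₂ _-_ (A≡G-G0 u) (A≡G-G0 l) ⟩
    (eval G u - eval G 0ℚ) - (eval G l - eval G 0ℚ)       ≡⟨ cancel (eval G u) (eval G l) (eval G 0ℚ) ⟩
    eval G u - eval G l                                   ∎
    where
    A = antideriv h
    A′≡G′ : ∀ y → eval (deriv A) y ≡ eval (deriv G) y
    A′≡G′ y = trans (cong (λ t → eval t y) (deriv-antideriv h)) (sym (G′≡h y))
    A≡G-G0 : ∀ x → eval A x ≡ eval G x - eval G 0ℚ
    A≡G-G0 x = begin
      eval A x                   ≡⟨ sym (trans (cong (λ t → eval A x - t) (eval-antideriv-0 h)) (+-identityʳ (eval A x))) ⟩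
      eval A x - eval A 0ℚ       ≡⟨ same-deriv⇒same-increment A G A′≡G′ x ⟩
      eval G x - eval G 0ℚ       ∎
    cancel : ∀ a b c → (a - c) - (b - c) ≡ a - b
    cancel = solve-∀ ℚ-ring

  ∫poly-cong : ∀ p q → (∀ x → eval p x ≡ eval q x) → ∀ l u → ∫poly p l u ≡ ∫poly q l u
  ∫poly-cong p q p≡q = fundamental-theorem (antideriv q) p (λ x → trans (cong (λ t → eval t x) (deriv-antideriv q)) (sym (p≡q x)))

  ∫poly-+ₚ : ∀ p q l u → ∫poly (p +ₚ q) l u ≡ ∫poly p l u + ∫poly q l u
  ∫poly-+ₚ p q l u = begin
    ∫poly (p +ₚ q) l u                            ≡⟨ fundamental-theorem (A +ₚ B) (p +ₚ q) A+B′≡p+q l u ⟩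
    eval (A +ₚ B) u - eval (A +ₚ B) l             ≡⟨ cong₂ _-_ (eval-+ₚ A B u) (eval-+ₚ A B l) ⟩
    (eval A u + eval B u) - (eval A l + eval B l) ≡⟨ interchange (eval A u) (eval B u) (eval A l) (eval B l) ⟩
    ∫poly p l u + ∫poly q l u                     ∎
    where
    A = antideriv p
    B = antideriv q
    A+B′≡p+q : ∀ x → eval (deriv (A +ₚ B)) x ≡ eval (p +ₚ q) x
    A+B′≡p+q x = begin
      eval (deriv (A +ₚ B)) x               ≡⟨ eval-deriv-+ₚ A B x ⟩
      eval (deriv A) x + eval (deriv B) x   ≡⟨ cong₂ (λ s t → eval s x + eval t x) (deriv-antideriv p) (deriv-antideriv q) ⟩
      eval p x + eval q x                   ≡⟨ sym (eval-+ₚ p q x) ⟩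
      eval (p +ₚ q) x                       ∎
    interchange : ∀ a b c d → (a + b) - (c + d) ≡ (a - c) + (b - d)
    interchange = solve-∀ ℚ-ring

  ∫poly-scaleₚ : ∀ r p l u → ∫poly (scaleₚ r p) l u ≡ r * ∫poly p l u
  ∫poly-scaleₚ r p l u = begin
    ∫poly (scaleₚ r p) l u                     ≡⟨ fundamental-theorem (scaleₚ r A) (scaleₚ r p) rA′≡rp l u ⟩
    eval (scaleₚ r A) u - eval (scaleₚ r A) l  ≡⟨ cong₂ _-_ (eval-scaleₚ r A u) (eval-scaleₚ r A l) ⟩
    r * eval A u - r * eval A l                ≡⟨ factor r (eval A u) (eval A l) ⟩
    r * ∫poly p l u                            ∎
    where
    A = antideriv p
    rA′≡rp : ∀ x → eval (deriv (scaleₚ r A)) x ≡ eval (scaleₚ r p) x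
    rA′≡rp x = trans (eval-deriv-scaleₚ r A x) (trans (cong (λ t → r * eval t x) (deriv-antideriv p)) (sym (eval-scaleₚ r p x)))
    factor : ∀ r a b → r * a - r * b ≡ r * (a - b)
    factor = solve-∀ ℚ-ring

  -- the points l + (u - l)/(j + 2) lie in (l, u) and are pairwise distinct
  ≡-on-interval⇒≡ : ∀ p q {l u} → l < u → (∀ x → l < x → x < u → eval p x ≡ eval q x) → ∀ x → eval p x ≡ eval q x
  ≡-on-interval⇒≡ p q {l} {u} l<u p≡q x = x-y≡0⇒x≡y _ _ (trans (sym (eval-subₚ p q x)) (p-q≡0 x))
    where
    w = u - l
    instance
      w-pos : ℚ.Positive w
      w-pos = ℚ.positive (subst (_< u - l) (+-inverseʳ l) (+-monoˡ-< (- l) l<u))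
    g : ℕ → ℚ
    g j = l + w * recip (suc (suc j))
    l<g : ∀ j → l < g j
    l<g j = subst (_< g j) (+-identityʳ l)
      (+-monoʳ-< l (positive⁻¹ (w * recip (suc (suc j))) {{pos*pos⇒pos w _ {{recip-pos (suc j)}}}}))
    g<u : ∀ j → g j < u
    g<u j = subst (g j <_) (l+[u-l]≡u l u) (+-monoʳ-< l (subst (w * recip (suc (suc j)) <_) (*-identityʳ w) (*-monoʳ-<-pos w recip<1)))
      where
      l+[u-l]≡u : ∀ l u → l + (u - l) ≡ u
      l+[u-l]≡u = solve-∀ ℚ-ring
      recip<1 : recip (suc (suc j)) < 1ℚ
      recip<1 = subst₂ _<_ (*-identityˡ (recip (suc (suc j)))) (recip-inverseʳ (suc j))
                         (÷-mono-< {1} {suc (suc j)} (suc j) (ℕ.s≤s (ℕ.s≤s ℕ.z≤n)))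
    g-injective : Injective _≡_ _≡_ g
    g-injective {i} {j} gi≡gj = ℕ.suc-injective (recip-injective (suc i) (suc j)
        (x-y≡0⇒x≡y _ _ (*-zero-cancelˡ w _ w≢0 (trans (factor l w _ _) (trans (cong (_- g j) gi≡gj) (+-inverseʳ (g j)))))))
      where
      w≢0 : w ≢ 0ℚ
      w≢0 w≡0 = <-irrefl (sym (x-y≡0⇒x≡y u l w≡0)) l<u
      factor : ∀ l w a b → w * (a - b) ≡ (l + w * a) - (l + w * b)
      factor = solve-∀ ℚ-ring
    p-q≡0 : ∀ x → eval (p -ₚ q) x ≡ 0ℚ
    p-q≡0 = vanishing-on-injective⇒≡0 (p -ₚ q) g g-injective
              (λ j → trans (eval-subₚ p q (g j)) (trans (cong (_- eval q (g j)) (p≡q (g j) (l<g j) (g<u j))) (+-inverseʳ (eval q (g j)))))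

  -- period 2 makes p constant (it takes one value on 0, 2, 4, ...),
  -- and then antiperiodicity forces that value to be 0
  antiperiodic⇒≡0 : ∀ p → (∀ y → eval p (y + 1ℚ) + eval p y ≡ 0ℚ) → ∀ y → eval p y ≡ 0ℚ
  antiperiodic⇒≡0 p antiperiodic y = trans (constant y) c≡0
    where
    c = eval p 0ℚ
    flip : ∀ y → eval p (y + 1ℚ) ≡ - eval p y
    flip y = x+y≡0⇒x≡-y _ _ (antiperiodic y)
    periodic : ∀ y → eval p (y + 1ℚ + 1ℚ) ≡ eval p y
    periodic y = trans (flip (y + 1ℚ)) (trans (cong -_ (flip y)) (neg-involutive (eval p y)))
    g : ℕ → ℚ
    g j = two * ℕ→ℚ j
    p[g]≡c : ∀ j → eval p (g j) ≡ c
    p[g]≡c zero    = cong (eval p) (*-zeroʳ two)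
    p[g]≡c (suc j) = trans (cong (eval p) (trans (cong (two *_) (ℕ→ℚ-suc j)) (expand (ℕ→ℚ j)))) (trans (periodic (g j)) (p[g]≡c j))
      where
      expand : ∀ a → (1ℚ + 1ℚ) * (1ℚ + a) ≡ (1ℚ + 1ℚ) * a + 1ℚ + 1ℚ
      expand = solve-∀ ℚ-ring
    g-injective : Injective _≡_ _≡_ g
    g-injective {i} {j} gi≡gj = ℕ→ℚ-injective (x-y≡0⇒x≡y _ _ (*-zero-cancelˡ two _ (λ ())
      (trans (*-distribˡ-+ two (ℕ→ℚ i) (- ℕ→ℚ j)) (trans (cong₂ _+_ gi≡gj (sym (neg-distribʳ-* two (ℕ→ℚ j)))) (+-inverseʳ (g j))))))
    constant : ∀ y → eval p y ≡ c
    constant y = x-y≡0⇒x≡y _ _ (trans (sym (trans (eval-subₚ p (c ∷ []) y) (cong (λ t → eval p y - t) (eval-const c y))))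
      (vanishing-on-injective⇒≡0 (p -ₚ (c ∷ [])) g g-injective
        (λ j → trans (eval-subₚ p (c ∷ []) (g j)) (trans (cong₂ _-_ (p[g]≡c j) (eval-const c (g j))) (+-inverseʳ c))) y))
    c≡0 : c ≡ 0ℚ
    c≡0 = x+x≡0⇒x≡0 c (trans (cong (_+ c) (sym (constant (0ℚ + 1ℚ)))) (antiperiodic 0ℚ))

  fundamental-theorem-combination : ∀ G h₁ h₂ κ → (∀ x → eval (deriv G) x ≡ eval h₁ x + κ * eval h₂ x) →
                                    ∀ l u → ∫poly h₁ l u + κ * ∫poly h₂ l u ≡ eval G u - eval G l
  fundamental-theorem-combination G h₁ h₂ κ G′≡h₁+κh₂ l u = begin
    ∫poly h₁ l u + κ * ∫poly h₂ l u           ≡⟨ cong (∫poly h₁ l u +_) (sym (∫poly-scaleₚ κ h₂ l u)) ⟩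
    ∫poly h₁ l u + ∫poly (scaleₚ κ h₂) l u    ≡⟨ sym (∫poly-+ₚ h₁ (scaleₚ κ h₂) l u) ⟩
    ∫poly (h₁ +ₚ scaleₚ κ h₂) l u             ≡⟨ fundamental-theorem G (h₁ +ₚ scaleₚ κ h₂) G′≡h l u ⟩
    eval G u - eval G l                       ∎
    where
    G′≡h : ∀ x → eval (deriv G) x ≡ eval (h₁ +ₚ scaleₚ κ h₂) x
    G′≡h x = trans (G′≡h₁+κh₂ x) (sym (trans (eval-+ₚ h₁ (scaleₚ κ h₂) x) (cong (eval h₁ x +_) (eval-scaleₚ κ h₂ x))))

module PiecewiseIntegral where

  open import Data.Nat as ℕ using (ℕ; zero; suc)
  import Data.Nat.Properties as ℕ
  open import Data.Nat.DivMod using (_/_; m/n*n≤m; m<n*o⇒m/o<n)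
  open import Data.Integer as ℤ using ()
  open import Data.Rational as ℚ using (ℚ; _+_; _-_; _<_; _≤_)
  open import Data.Rational.Properties using (≤-<-trans; <-≤-trans)
  open import Data.Product using (Σ; _,_; proj₁; proj₂; _×_)
  open import Relation.Binary.PropositionalEquality
  open import Defs
  open Arithmetic
  open Summation
  open PolynomialFunction
  open PiecewisePoly01
  open ≡-Reasoning

  ∫grid : ℕ → (ℕ → Poly) → ℚ
  ∫grid N F = ∑ N (λ k → ∫poly (F k) (k ÷ N) (suc k ÷ N))

  private
    -- ∫₀¹ sums with a local helper; as for antideriv, with-abstraction names it
    partialSum-exists : Σ (∀ {f} → PiecewisePoly01 f → ℕ → ℚ) λ S → ∀ {f} (R : PiecewisePoly01 f) → ∫₀¹ R ≡ S R (cells R)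
    partialSum-exists = S , unfold
      where
      S : ∀ {f} → PiecewisePoly01 f → ℕ → ℚ
      S = _
      unfold : ∀ {f} (R : PiecewisePoly01 f) → ∫₀¹ R ≡ S R (cells R)
      unfold R with cells R
      ... | _ = refl

    partialSum : ∀ {f} → PiecewisePoly01 f → ℕ → ℚ
    partialSum = proj₁ partialSum-exists

    cell-endpoint : ∀ {f} (R : PiecewisePoly01 f) i → (ℤ.+ i) ℚ./ cells R ≡ i ÷ cells R
    cell-endpoint record { cells = M ; cells≢0 = M≢0 } i = +/≡÷ i M {{M≢0}}

    partialSum≡∫grid : ∀ {f} (R : PiecewisePoly01 f) n →
                       partialSum R n ≡ ∑ n (λ k → ∫poly (piece R k) (k ÷ cells R) (suc k ÷ cells R))
    partialSum≡∫grid R zero    = refl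
    partialSum≡∫grid R (suc n) = begin
      partialSum R n + ∫poly (piece R n) ((ℤ.+ n) ℚ./ cells R) ((ℤ.+ suc n) ℚ./ cells R)
        ≡⟨ cong₂ _+_ (partialSum≡∫grid R n) (cong₂ (∫poly (piece R n)) (cell-endpoint R n) (cell-endpoint R (suc n))) ⟩
      ∑ n T + T n
        ≡⟨ sym (∑-init-last n T) ⟩
      ∑ (suc n) T
        ∎
      where
      T : ℕ → ℚ
      T k = ∫poly (piece R k) (k ÷ cells R) (suc k ÷ cells R)

  ∫₀¹≡∫grid : ∀ {f} (R : PiecewisePoly01 f) → ∫₀¹ R ≡ ∫grid (cells R) (piece R)
  ∫₀¹≡∫grid R = trans (proj₂ partialSum-exists R) (partialSum≡∫grid R (cells R))

  ∫grid-refine : ∀ F M K → ∫grid (suc M) F ≡ ∫grid (suc M ℕ.* suc K) (λ i → F (i / suc K))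
  ∫grid-refine F M K = sym (begin
    ∑ (suc M ℕ.* suc K) T                                          ≡⟨ ∑-* (suc M) (suc K) T ⟩
    ∑ (suc M) (λ k → ∑ (suc K) (λ j → T (k ℕ.* suc K ℕ.+ j)))       ≡⟨ ∑-cong (suc M) coarse-cell ⟩
    ∫grid (suc M) F                                                ∎)
    where
    N = suc M ℕ.* suc K
    T : ℕ → ℚ
    T i = ∫poly (F (i / suc K)) (i ÷ N) (suc i ÷ N)
    coarse-cell : ∀ k → ∑ (suc K) (λ j → T (k ℕ.* suc K ℕ.+ j)) ≡ ∫poly (F k) (k ÷ suc M) (suc k ÷ suc M)
    coarse-cell k = begin
      ∑ (suc K) (λ j → T (k ℕ.* suc K ℕ.+ j))
        ≡⟨ ∑-cong-< (suc K) (λ j j<K → cong (λ c → ∫poly (F c) ((k ℕ.* suc K ℕ.+ j) ÷ N) (suc (k ℕ.* suc K ℕ.+ j) ÷ N))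
                                             (proj₁ (divMod-unique _ k j (suc K) j<K (ℕ.+-comm (k ℕ.* suc K) j)))) ⟩
      ∑ (suc K) (λ j → G (suc (k ℕ.* suc K ℕ.+ j) ÷ N) - G ((k ℕ.* suc K ℕ.+ j) ÷ N))
        ≡⟨ ∑-cong (suc K) (λ j → cong (λ z → G (z ÷ N) - G ((k ℕ.* suc K ℕ.+ j) ÷ N)) (sym (ℕ.+-suc (k ℕ.* suc K) j))) ⟩
      ∑ (suc K) (λ j → g (suc j) - g j)
        ≡⟨ ∑-telescope (suc K) g ⟩
      g (suc K) - g 0
        ≡⟨ cong₂ (λ u v → G u - G v)
             (trans (cong (_÷ N) (ℕ.+-comm (k ℕ.* suc K) (suc K))) (*÷*-cancelʳ (suc k) (suc M) K))
             (trans (cong (_÷ N) (ℕ.+-identityʳ (k ℕ.* suc K))) (*÷*-cancelʳ k (suc M) K)) ⟩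
      G (suc k ÷ suc M) - G (k ÷ suc M)
        ∎
      where
      G : ℚ → ℚ
      G = eval (antideriv (F k))
      g : ℕ → ℚ
      g j = G ((k ℕ.* suc K ℕ.+ j) ÷ N)

  fine-cell⊆coarse-cell : ∀ M K i x → i ÷ (suc M ℕ.* suc K) < x → x < suc i ÷ (suc M ℕ.* suc K) →
                          (i / suc K) ÷ suc M < x × x < suc (i / suc K) ÷ suc M
  fine-cell⊆coarse-cell M K i x lo hi =
      ≤-<-trans (subst (_≤ i ÷ N) (*÷*-cancelʳ k (suc M) K) (÷-mono-≤ (K ℕ.+ M ℕ.* suc K) (m/n*n≤m i (suc K)))) lo
    , <-≤-trans hi (subst (suc i ÷ N ≤_) (*÷*-cancelʳ (suc k) (suc M) K) (÷-mono-≤ (K ℕ.+ M ℕ.* suc K) (m<[1+m/n]*n i (suc K))))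
    where
    N = suc M ℕ.* suc K
    k = i / suc K

  ∫₀¹-unique : ∀ {f} (R₁ R₂ : PiecewisePoly01 f) → ∫₀¹ R₁ ≡ ∫₀¹ R₂
  ∫₀¹-unique R₁@record { cells = suc m₁ } R₂@record { cells = suc m₂ } = begin
    ∫₀¹ R₁                                          ≡⟨ ∫₀¹≡∫grid R₁ ⟩
    ∫grid (suc m₁) (piece R₁)                       ≡⟨ ∫grid-refine (piece R₁) m₁ m₂ ⟩
    ∑ N (λ i → ∫poly (P₁ i) (i ÷ N) (suc i ÷ N))     ≡⟨ ∑-cong-< N same-integral ⟩
    ∑ N (λ i → ∫poly (P₂ i) (i ÷ N) (suc i ÷ N))     ≡⟨ cong (λ M → ∫grid M P₂) (ℕ.*-comm (suc m₁) (suc m₂)) ⟩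
    ∫grid (suc m₂ ℕ.* suc m₁) P₂                    ≡⟨ sym (∫grid-refine (piece R₂) m₂ m₁) ⟩
    ∫grid (suc m₂) (piece R₂)                       ≡⟨ sym (∫₀¹≡∫grid R₂) ⟩
    ∫₀¹ R₂                                          ∎
    where
    N = suc m₁ ℕ.* suc m₂
    P₁ P₂ : ℕ → Poly
    P₁ i = piece R₁ (i / suc m₂)
    P₂ i = piece R₂ (i / suc m₁)
    same-integral : ∀ i → i ℕ.< N → ∫poly (P₁ i) (i ÷ N) (suc i ÷ N) ≡ ∫poly (P₂ i) (i ÷ N) (suc i ÷ N)
    same-integral i i<N = ∫poly-cong (P₁ i) (P₂ i)
      (≡-on-interval⇒≡ (P₁ i) (P₂ i) (÷-mono-< (m₂ ℕ.+ m₁ ℕ.* suc m₂) (ℕ.n<1+n i)) P₁≡P₂) (i ÷ N) (suc i ÷ N)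
      where
      i<N′ : i ℕ.< suc m₂ ℕ.* suc m₁
      i<N′ = subst (i ℕ.<_) (ℕ.*-comm (suc m₁) (suc m₂)) i<N
      N≡N′ : ∀ j → j ÷ N ≡ j ÷ (suc m₂ ℕ.* suc m₁)
      N≡N′ j = cong (j ÷_) (ℕ.*-comm (suc m₁) (suc m₂))
      P₁≡P₂ : ∀ x → i ÷ N < x → x < suc i ÷ N → eval (P₁ i) x ≡ eval (P₂ i) x
      P₁≡P₂ x lo hi =
        let (lo₁ , hi₁) = fine-cell⊆coarse-cell m₁ m₂ i x lo hi
            (lo₂ , hi₂) = fine-cell⊆coarse-cell m₂ m₁ i x (subst (_< x) (N≡N′ i) lo) (subst (x <_) (N≡N′ (suc i)) hi)
        in trans (sym (agrees R₁ (i / suc m₂) (m<n*o⇒m/o<n i<N) x (subst (_< x) (sym (+/≡÷ (i / suc m₂) (suc m₁))) lo₁)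
                                                                (subst (x <_) (sym (+/≡÷ (suc (i / suc m₂)) (suc m₁))) hi₁)))
                 (agrees R₂ (i / suc m₁) (m<n*o⇒m/o<n i<N′) x (subst (_< x) (sym (+/≡÷ (i / suc m₁) (suc m₂))) lo₂)
                                                              (subst (x <_) (sym (+/≡÷ (suc (i / suc m₁)) (suc m₂))) hi₂))

module Binomial where

  open import Data.Nat as ℕ using (ℕ; zero; suc)
  import Data.Nat.Properties as ℕ
  open import Data.Nat.Combinatorics using (_C_; nCk+nC[k+1]≡[n+1]C[k+1]; nC1≡n)
  import Data.Nat.Tactic.RingSolver as ℕ-Solver
  open import Relation.Binary.PropositionalEquality
  open ≡-Reasoning

  [k+1]*[n+1]C[k+1]≡[n+1]*nCk : ∀ n k → suc k ℕ.* (suc n C suc k) ≡ suc n ℕ.* (n C k)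
  [k+1]*[n+1]C[k+1]≡[n+1]*nCk zero    zero    = refl
  [k+1]*[n+1]C[k+1]≡[n+1]*nCk zero    (suc k) = ℕ.*-zeroʳ (suc (suc k))
  [k+1]*[n+1]C[k+1]≡[n+1]*nCk (suc n) zero    =
    trans (ℕ.*-identityˡ (suc (suc n) C 1)) (trans (nC1≡n (suc (suc n))) (sym (ℕ.*-identityʳ (suc (suc n)))))
  [k+1]*[n+1]C[k+1]≡[n+1]*nCk (suc n) (suc k) = begin
    suc (suc k) ℕ.* (suc (suc n) C suc (suc k))   ≡⟨ cong (suc (suc k) ℕ.*_) (sym (nCk+nC[k+1]≡[n+1]C[k+1] (suc n) (suc k))) ⟩
    suc (suc k) ℕ.* (A ℕ.+ B)                     ≡⟨ expand k A B ⟩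
    suc k ℕ.* A ℕ.+ A ℕ.+ suc (suc k) ℕ.* B       ≡⟨ cong₂ (λ s t → s ℕ.+ A ℕ.+ t) ([k+1]*[n+1]C[k+1]≡[n+1]*nCk n k)
                                                                                   ([k+1]*[n+1]C[k+1]≡[n+1]*nCk n (suc k)) ⟩
    suc n ℕ.* c ℕ.+ A ℕ.+ suc n ℕ.* d             ≡⟨ collect n c A d ⟩
    suc n ℕ.* (c ℕ.+ d) ℕ.+ A                     ≡⟨ cong (λ t → suc n ℕ.* t ℕ.+ A) (nCk+nC[k+1]≡[n+1]C[k+1] n k) ⟩
    suc n ℕ.* A ℕ.+ A                             ≡⟨ ℕ.+-comm (suc n ℕ.* A) A ⟩
    suc (suc n) ℕ.* A                             ∎
    where
    A = suc n C suc k
    B = suc n C suc (suc k)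
    c = n C k
    d = n C suc k
    expand : ∀ k A B → suc (suc k) ℕ.* (A ℕ.+ B) ≡ suc k ℕ.* A ℕ.+ A ℕ.+ suc (suc k) ℕ.* B
    expand = ℕ-Solver.solve-∀
    collect : ∀ n c A d → suc n ℕ.* c ℕ.+ A ℕ.+ suc n ℕ.* d ≡ suc n ℕ.* (c ℕ.+ d) ℕ.+ A
    collect = ℕ-Solver.solve-∀

  [n+1]*[p+n+1]C[n+1]≡[p+1]*[p+n+1]Cn : ∀ p n → suc n ℕ.* (suc (p ℕ.+ n) C suc n) ≡ suc p ℕ.* (suc (p ℕ.+ n) C n)
  [n+1]*[p+n+1]C[n+1]≡[p+1]*[p+n+1]Cn p zero rewrite ℕ.+-identityʳ p =
    trans (ℕ.*-identityˡ (suc p C 1)) (trans (nC1≡n (suc p)) (sym (ℕ.*-identityʳ (suc p))))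
  [n+1]*[p+n+1]C[n+1]≡[p+1]*[p+n+1]Cn p (suc n) rewrite ℕ.+-suc p n = begin
    suc (suc n) ℕ.* (suc M C suc (suc n))                  ≡⟨ [k+1]*[n+1]C[k+1]≡[n+1]*nCk M (suc n) ⟩
    suc M ℕ.* (M C suc n)                                  ≡⟨ split n p (M C suc n) ⟩
    suc n ℕ.* (M C suc n) ℕ.+ suc p ℕ.* (M C suc n)        ≡⟨ cong (ℕ._+ suc p ℕ.* (M C suc n)) ([n+1]*[p+n+1]C[n+1]≡[p+1]*[p+n+1]Cn p n) ⟩
    suc p ℕ.* (M C n) ℕ.+ suc p ℕ.* (M C suc n)            ≡⟨ sym (ℕ.*-distribˡ-+ (suc p) (M C n) (M C suc n)) ⟩
    suc p ℕ.* (M C n ℕ.+ M C suc n)                        ≡⟨ cong (suc p ℕ.*_) (nCk+nC[k+1]≡[n+1]C[k+1] M n) ⟩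
    suc p ℕ.* (suc M C suc n)                              ∎
    where
    M = suc (p ℕ.+ n)
    split : ∀ n p x → suc (suc (p ℕ.+ n)) ℕ.* x ≡ suc n ℕ.* x ℕ.+ suc p ℕ.* x
    split = ℕ-Solver.solve-∀

module EulerPolynomial where

  open import Data.Nat as ℕ using (ℕ; zero; suc)
  open import Data.Nat.DivMod using (_%_)
  import Data.Nat.Properties as ℕ
  open import Data.Nat.Induction using (<-rec)
  open import Data.Nat.Combinatorics using (_C_)
  open import Data.Rational using (ℚ; 0ℚ; 1ℚ; _+_; _*_; _-_; -_)
  open import Data.Rational.Properties
  open import Data.List using (List; []; _∷_; _∷ʳ_; applyUpTo)
  open import Data.List.Properties using (applyUpTo-∷ʳ)
  open import Data.Product using (Σ; _,_; proj₁; proj₂)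
  open import Function.Base using (_∋_)
  open import Relation.Binary.PropositionalEquality
  open import Tactic.RingSolver using (solve-∀)
  open import Defs
  open Arithmetic
  open Binomial
  open Summation
  open Polynomial
  open PolynomialFunction
  open ≡-Reasoning

  private
    -- binomSum and last are private to Defs; they are recovered as for antideriv
    binomSum-exists : Σ (ℕ → ℕ → List Poly → Poly) λ B → ∀ k →
      eulerList (suc k) ≡ eulerList k ∷ʳ (monoₚ (suc k) +ₚ scaleₚ (- half) (B (suc k) 0 (eulerList k)))
    binomSum-exists = B , unfold
      where
      B : ℕ → ℕ → List Poly → Poly
      B = _
      unfold : ∀ k → eulerList (suc k) ≡ eulerList k ∷ʳ (monoₚ (suc k) +ₚ scaleₚ (- half) (B (suc k) 0 (eulerList k)))
      unfold k with _+ₚ_ | scaleₚ | suc k | eulerList k | 0 | 0ℚ | - half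
      ... | _ | _ | _ | _ | _ | _ | _ = refl

    binomSum : ℕ → ℕ → List Poly → Poly
    binomSum = proj₁ binomSum-exists

    last-exists : Σ (Poly → List Poly → Poly) λ L → ∀ k → EulerPoly k ≡ L [] (eulerList k)
    last-exists = L , unfold
      where
      L : Poly → List Poly → Poly
      L = _
      unfold : ∀ k → EulerPoly k ≡ L [] (eulerList k)
      unfold k with eulerList k | Poly ∋ []
      ... | _ | _ = refl

    last : Poly → List Poly → Poly
    last = proj₁ last-exists

    last-∷ʳ : ∀ d xs y → last d (xs ∷ʳ y) ≡ y
    last-∷ʳ d []       y = refl
    last-∷ʳ d (x ∷ xs) y = last-∷ʳ x xs y

    EulerPoly-suc : ∀ k → EulerPoly (suc k) ≡ monoₚ (suc k) +ₚ scaleₚ (- half) (binomSum (suc k) 0 (eulerList k))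
    EulerPoly-suc k = trans (proj₂ last-exists (suc k)) (trans (cong (last []) (proj₂ binomSum-exists k)) (last-∷ʳ [] (eulerList k) _))

    eulerList≡applyUpTo : ∀ k → eulerList k ≡ applyUpTo EulerPoly (suc k)
    eulerList≡applyUpTo zero    = refl
    eulerList≡applyUpTo (suc k) = begin
      eulerList (suc k)                                 ≡⟨ proj₂ binomSum-exists k ⟩
      eulerList k ∷ʳ _                                  ≡⟨ cong₂ _∷ʳ_ (eulerList≡applyUpTo k) (sym (EulerPoly-suc k)) ⟩
      applyUpTo EulerPoly (suc k) ∷ʳ EulerPoly (suc k)  ≡⟨ applyUpTo-∷ʳ EulerPoly (suc k) ⟩
      applyUpTo EulerPoly (suc (suc k))                 ∎

  -- applied to the defining list recursion of EulerPoly, any linear functional (evaluation, evaluation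
  -- of the derivative) yields the recurrence E_k = x^k - ½ Σ_{i<k} C(k, i) E_i
  record LinearFunctional (φ : Poly → ℚ) : Set where
    field
      φ-[]     : φ [] ≡ 0ℚ
      φ-+ₚ     : ∀ p q → φ (p +ₚ q) ≡ φ p + φ q
      φ-scaleₚ : ∀ r p → φ (scaleₚ r p) ≡ r * φ p

  private
    φ-binomSum : ∀ {φ} → LinearFunctional φ → ∀ K j n (g : ℕ → Poly) →
                 φ (binomSum K j (applyUpTo g n)) ≡ ∑ n (λ i → ℕ→ℚ (K C (j ℕ.+ i)) * φ (g i))
    φ-binomSum L K j zero    g = LinearFunctional.φ-[] L
    φ-binomSum {φ} L K j (suc n) g = begin
      φ (scaleₚ (ℕ→ℚ (K C j)) (g 0) +ₚ binomSum K (suc j) (applyUpTo (λ i → g (suc i)) n))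
        ≡⟨ LinearFunctional.φ-+ₚ L _ _ ⟩
      φ (scaleₚ (ℕ→ℚ (K C j)) (g 0)) + φ (binomSum K (suc j) (applyUpTo (λ i → g (suc i)) n))
        ≡⟨ cong₂ _+_ (LinearFunctional.φ-scaleₚ L _ _) (φ-binomSum L K (suc j) n (λ i → g (suc i))) ⟩
      ℕ→ℚ (K C j) * φ (g 0) + ∑ n (λ i → ℕ→ℚ (K C (suc j ℕ.+ i)) * φ (g (suc i)))
        ≡⟨ cong₂ _+_ (cong (λ t → ℕ→ℚ (K C t) * φ (g 0)) (sym (ℕ.+-identityʳ j)))
                     (∑-cong n (λ i → cong (λ t → ℕ→ℚ (K C t) * φ (g (suc i))) (sym (ℕ.+-suc j i)))) ⟩
      ∑ (suc n) (λ i → ℕ→ℚ (K C (j ℕ.+ i)) * φ (g i))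
        ∎

  φ-EulerPoly : ∀ {φ} → LinearFunctional φ → ∀ k →
                φ (EulerPoly k) ≡ φ (monoₚ k) + (- half) * ∑ k (λ i → ℕ→ℚ (k C i) * φ (EulerPoly i))
  φ-EulerPoly {φ} L zero    = sym (trans (cong (φ (1ℚ ∷ []) +_) (*-zeroʳ (- half))) (+-identityʳ _))
  φ-EulerPoly {φ} L (suc k) = begin
    φ (EulerPoly (suc k))
      ≡⟨ cong φ (EulerPoly-suc k) ⟩
    φ (monoₚ (suc k) +ₚ scaleₚ (- half) (binomSum (suc k) 0 (eulerList k)))
      ≡⟨ LinearFunctional.φ-+ₚ L _ _ ⟩
    φ (monoₚ (suc k)) + φ (scaleₚ (- half) (binomSum (suc k) 0 (eulerList k)))
      ≡⟨ cong (φ (monoₚ (suc k)) +_) (LinearFunctional.φ-scaleₚ L _ _) ⟩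
    φ (monoₚ (suc k)) + (- half) * φ (binomSum (suc k) 0 (eulerList k))
      ≡⟨ cong (λ es → φ (monoₚ (suc k)) + (- half) * φ (binomSum (suc k) 0 es)) (eulerList≡applyUpTo k) ⟩
    φ (monoₚ (suc k)) + (- half) * φ (binomSum (suc k) 0 (applyUpTo EulerPoly (suc k)))
      ≡⟨ cong (λ t → φ (monoₚ (suc k)) + (- half) * t) (φ-binomSum L (suc k) 0 (suc k) EulerPoly) ⟩
    φ (monoₚ (suc k)) + (- half) * ∑ (suc k) (λ i → ℕ→ℚ (suc k C i) * φ (EulerPoly i))
      ∎

  eval-linear : ∀ x → LinearFunctional (λ p → eval p x)
  eval-linear x = record { φ-[] = refl ; φ-+ₚ = λ p q → eval-+ₚ p q x ; φ-scaleₚ = λ r p → eval-scaleₚ r p x }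

  eval-deriv-linear : ∀ x → LinearFunctional (λ p → eval (deriv p) x)
  eval-deriv-linear x = record { φ-[] = refl ; φ-+ₚ = λ p q → eval-deriv-+ₚ p q x ; φ-scaleₚ = λ r p → eval-deriv-scaleₚ r p x }

  E-recurrence : ∀ k x → E k x ≡ x ^ℚ k + (- half) * ∑ k (λ i → ℕ→ℚ (k C i) * E i x)
  E-recurrence k x = trans (φ-EulerPoly (eval-linear x) k) (cong (_+ (- half) * ∑ k (λ i → ℕ→ℚ (k C i) * E i x)) (eval-monoₚ k x))

  eval-deriv-EulerPoly : ∀ k x → eval (deriv (EulerPoly (suc k))) x ≡ ℕ→ℚ (suc k) * E k x
  eval-deriv-EulerPoly = <-rec _ step
    where
    step : ∀ k → (∀ {i} → i ℕ.< k → ∀ x → eval (deriv (EulerPoly (suc i))) x ≡ ℕ→ℚ (suc i) * E i x) →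
           ∀ x → eval (deriv (EulerPoly (suc k))) x ≡ ℕ→ℚ (suc k) * E k x
    step k IH x = begin
      eval (deriv (EulerPoly (suc k))) x
        ≡⟨ φ-EulerPoly (eval-deriv-linear x) (suc k) ⟩
      eval (deriv (monoₚ (suc k))) x + (- half) * ∑ (suc k) (λ i → ℕ→ℚ (suc k C i) * eval (deriv (EulerPoly i)) x)
        ≡⟨ cong₂ (λ s t → s + (- half) * t) (eval-deriv-monoₚ k x) (trans (cong (_+ S) (*-zeroʳ (ℕ→ℚ (suc k C 0)))) (+-identityˡ S)) ⟩
      K * x ^ℚ k + (- half) * ∑ k (λ i → ℕ→ℚ (suc k C suc i) * eval (deriv (EulerPoly (suc i))) x)
        ≡⟨ cong (λ t → K * x ^ℚ k + (- half) * t) (trans (∑-cong-< k term) (sym (*-distribˡ-∑ k K _))) ⟩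
      K * x ^ℚ k + (- half) * (K * ∑ k (λ i → ℕ→ℚ (k C i) * E i x))
        ≡⟨ factor K (x ^ℚ k) (- half) _ ⟩
      K * (x ^ℚ k + (- half) * ∑ k (λ i → ℕ→ℚ (k C i) * E i x))
        ≡⟨ cong (K *_) (sym (E-recurrence k x)) ⟩
      K * E k x
        ∎
      where
      K = ℕ→ℚ (suc k)
      S = ∑ k (λ i → ℕ→ℚ (suc k C suc i) * eval (deriv (EulerPoly (suc i))) x)
      factor : ∀ K p h s → K * p + h * (K * s) ≡ K * (p + h * s)
      factor = solve-∀ ℚ-ring
      term : ∀ i → i ℕ.< k → ℕ→ℚ (suc k C suc i) * eval (deriv (EulerPoly (suc i))) x ≡ K * (ℕ→ℚ (k C i) * E i x)
      term i i<k = begin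
        ℕ→ℚ (suc k C suc i) * eval (deriv (EulerPoly (suc i))) x   ≡⟨ cong (ℕ→ℚ (suc k C suc i) *_) (IH i<k x) ⟩
        ℕ→ℚ (suc k C suc i) * (ℕ→ℚ (suc i) * E i x)                ≡⟨ sym (*-assoc (ℕ→ℚ (suc k C suc i)) (ℕ→ℚ (suc i)) (E i x)) ⟩
        ℕ→ℚ (suc k C suc i) * ℕ→ℚ (suc i) * E i x                  ≡⟨ cong (_* E i x) (sym (ℕ→ℚ-homo-* (suc k C suc i) (suc i))) ⟩
        ℕ→ℚ ((suc k C suc i) ℕ.* suc i) * E i x                     ≡⟨ cong (λ t → ℕ→ℚ t * E i x) (trans (ℕ.*-comm (suc k C suc i) (suc i))
                                                                                                         ([k+1]*[n+1]C[k+1]≡[n+1]*nCk k i)) ⟩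
        ℕ→ℚ (suc k ℕ.* (k C i)) * E i x                            ≡⟨ cong (_* E i x) (ℕ→ℚ-homo-* (suc k) (k C i)) ⟩
        K * ℕ→ℚ (k C i) * E i x                                    ≡⟨ *-assoc K (ℕ→ℚ (k C i)) (E i x) ⟩
        K * (ℕ→ℚ (k C i) * E i x)                                  ∎

  private
    ∑-binomial-at-0 : ∀ k → ∑ k (λ i → ℕ→ℚ (k C i) * 0ℚ ^ℚ i) + 0ℚ ^ℚ k ≡ 1ℚ
    ∑-binomial-at-0 zero    = refl
    ∑-binomial-at-0 (suc k) = begin
      ℕ→ℚ (suc k C 0) * 1ℚ + ∑ k (λ i → ℕ→ℚ (suc k C suc i) * 0ℚ ^ℚ suc i) + 0ℚ ^ℚ suc k
        ≡⟨ cong₂ (λ s t → ℕ→ℚ (suc k C 0) * 1ℚ + s + t)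
             (trans (∑-cong k (λ i → trans (cong (ℕ→ℚ (suc k C suc i) *_) (0^suc i)) (*-zeroʳ (ℕ→ℚ (suc k C suc i))))) (∑-zero k))
             (0^suc k) ⟩
      1ℚ * 1ℚ + 0ℚ + 0ℚ
        ≡⟨ refl ⟩
      1ℚ
        ∎

    shift-defect : ℕ → Poly
    shift-defect k = (comp (EulerPoly k) (lin 1ℚ 1ℚ) +ₚ EulerPoly k) -ₚ scaleₚ two (monoₚ k)

    eval-lin-1-1 : ∀ y → eval (lin 1ℚ 1ℚ) y ≡ y + 1ℚ
    eval-lin-1-1 y = trans (eval-lin 1ℚ 1ℚ y) (cong (_+ 1ℚ) (*-identityˡ y))

    eval-shift-defect : ∀ k y → eval (shift-defect k) y ≡ E k (y + 1ℚ) + E k y - two * y ^ℚ k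
    eval-shift-defect k y = begin
      eval (shift-defect k) y
        ≡⟨ eval-subₚ (shifted +ₚ EulerPoly k) (scaleₚ two (monoₚ k)) y ⟩
      eval (shifted +ₚ EulerPoly k) y - eval (scaleₚ two (monoₚ k)) y
        ≡⟨ cong₂ _-_ (eval-+ₚ shifted (EulerPoly k) y) (trans (eval-scaleₚ two (monoₚ k) y) (cong (two *_) (eval-monoₚ k y))) ⟩
      eval shifted y + E k y - two * y ^ℚ k
        ≡⟨ cong (λ t → t + E k y - two * y ^ℚ k) (trans (eval-comp (EulerPoly k) (lin 1ℚ 1ℚ) y) (cong (E k) (eval-lin-1-1 y))) ⟩
      E k (y + 1ℚ) + E k y - two * y ^ℚ k
        ∎
      where
      shifted = comp (EulerPoly k) (lin 1ℚ 1ℚ)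

    eval-deriv-shift-defect-0 : ∀ y → eval (deriv (shift-defect 0)) y ≡ 0ℚ
    eval-deriv-shift-defect-0 y = trans (cong (0ℚ +_) (*-zeroʳ y)) (+-identityʳ 0ℚ)

    eval-deriv-shift-defect : ∀ k y → eval (deriv (shift-defect (suc k))) y ≡ ℕ→ℚ (suc k) * eval (shift-defect k) y
    eval-deriv-shift-defect k y = begin
      eval (deriv (shift-defect (suc k))) y
        ≡⟨ eval-deriv-subₚ (shifted +ₚ EulerPoly (suc k)) (scaleₚ two (monoₚ (suc k))) y ⟩
      eval (deriv (shifted +ₚ EulerPoly (suc k))) y - eval (deriv (scaleₚ two (monoₚ (suc k)))) y
        ≡⟨ cong₂ _-_ (eval-deriv-+ₚ shifted (EulerPoly (suc k)) y) (eval-deriv-scaleₚ two (monoₚ (suc k)) y) ⟩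
      eval (deriv shifted) y + E′ y - two * eval (deriv (monoₚ (suc k))) y
        ≡⟨ cong₂ (λ u w → u + E′ y - two * w)
             (trans (eval-deriv-comp (EulerPoly (suc k)) (lin 1ℚ 1ℚ) y)
                    (cong₂ (λ u z → u * E′ z) (eval-deriv-lin 1ℚ 1ℚ y) (eval-lin-1-1 y)))
             (eval-deriv-monoₚ k y) ⟩
      1ℚ * E′ (y + 1ℚ) + E′ y - two * (K * y ^ℚ k)
        ≡⟨ cong₂ (λ u v → 1ℚ * u + v - two * (K * y ^ℚ k)) (eval-deriv-EulerPoly k (y + 1ℚ)) (eval-deriv-EulerPoly k y) ⟩
      1ℚ * (K * E k (y + 1ℚ)) + K * E k y - two * (K * y ^ℚ k)
        ≡⟨ factor K (E k (y + 1ℚ)) (E k y) two (y ^ℚ k) ⟩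
      K * (E k (y + 1ℚ) + E k y - two * y ^ℚ k)
        ≡⟨ cong (K *_) (sym (eval-shift-defect k y)) ⟩
      K * eval (shift-defect k) y
        ∎
      where
      K = ℕ→ℚ (suc k)
      shifted = comp (EulerPoly (suc k)) (lin 1ℚ 1ℚ)
      E′ = eval (deriv (EulerPoly (suc k)))
      factor : ∀ K a b t p → 1ℚ * (K * a) + K * b - t * (K * p) ≡ K * (a + b - t * p)
      factor = solve-∀ ℚ-ring

    -- the recurrence at 1 and at 0, with E_i(1) = 2·0^i - E_i(0) for i < k
    E[1]+E[0] : ∀ k → (∀ {i} → i ℕ.< k → E i 1ℚ + E i 0ℚ ≡ two * 0ℚ ^ℚ i) → E k 1ℚ + E k 0ℚ ≡ two * 0ℚ ^ℚ k
    E[1]+E[0] k IH = x-y≡0⇒x≡y _ _ (begin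
      E k 1ℚ + E k 0ℚ - two * 0ℚ ^ℚ k
        ≡⟨ cong₂ (λ s t → s + t - two * 0ℚ ^ℚ k) (E-recurrence k 1ℚ) (E-recurrence k 0ℚ) ⟩
      (1ℚ ^ℚ k + (- half) * S₁) + (0ℚ ^ℚ k + (- half) * S) - two * 0ℚ ^ℚ k
        ≡⟨ cong₂ (λ s t → (s + (- half) * t) + (0ℚ ^ℚ k + (- half) * S) - two * 0ℚ ^ℚ k) (1^ k) S₁≡2S₀-S ⟩
      (1ℚ + (- half) * (two * S₀ - S)) + (0ℚ ^ℚ k + (- half) * S) - two * 0ℚ ^ℚ k
        ≡⟨ regroup half S₀ S (0ℚ ^ℚ k) ⟩
      1ℚ - ((half * two) * S₀ + 0ℚ ^ℚ k)
        ≡⟨ cong (λ t → 1ℚ - (t + 0ℚ ^ℚ k)) (*-identityˡ S₀) ⟩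
      1ℚ - (S₀ + 0ℚ ^ℚ k)
        ≡⟨ cong (λ t → 1ℚ - t) (∑-binomial-at-0 k) ⟩
      1ℚ - 1ℚ
        ≡⟨ +-inverseʳ 1ℚ ⟩
      0ℚ
        ∎)
      where
      S  = ∑ k (λ i → ℕ→ℚ (k C i) * E i 0ℚ)
      S₀ = ∑ k (λ i → ℕ→ℚ (k C i) * 0ℚ ^ℚ i)
      S₁ = ∑ k (λ i → ℕ→ℚ (k C i) * E i 1ℚ)
      S₁≡2S₀-S : S₁ ≡ two * S₀ - S
      S₁≡2S₀-S = begin
        S₁
          ≡⟨ ∑-cong-< k (λ i i<k → cong (ℕ→ℚ (k C i) *_) (x+y≡z⇒x≡z-y (IH i<k))) ⟩
        ∑ k (λ i → ℕ→ℚ (k C i) * (two * 0ℚ ^ℚ i - E i 0ℚ))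
          ≡⟨ ∑-cong k (λ i → split (ℕ→ℚ (k C i)) (0ℚ ^ℚ i) (E i 0ℚ)) ⟩
        ∑ k (λ i → two * (ℕ→ℚ (k C i) * 0ℚ ^ℚ i) + - (ℕ→ℚ (k C i) * E i 0ℚ))
          ≡⟨ ∑-distrib-+ k _ _ ⟩
        ∑ k (λ i → two * (ℕ→ℚ (k C i) * 0ℚ ^ℚ i)) + ∑ k (λ i → - (ℕ→ℚ (k C i) * E i 0ℚ))
          ≡⟨ cong₂ _+_ (sym (*-distribˡ-∑ k two _)) (∑-neg k _) ⟩
        two * S₀ - S
          ∎
        where
        x+y≡z⇒x≡z-y : ∀ {x y z} → x + y ≡ z → x ≡ z - y
        x+y≡z⇒x≡z-y {x} {y} refl = sym (trans (+-assoc x y (- y)) (trans (cong (x +_) (+-inverseʳ y)) (+-identityʳ x)))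
        split : ∀ c z e → c * ((1ℚ + 1ℚ) * z - e) ≡ (1ℚ + 1ℚ) * (c * z) + - (c * e)
        split = solve-∀ ℚ-ring
      regroup : ∀ h S₀ S z → (1ℚ + (- h) * ((1ℚ + 1ℚ) * S₀ - S)) + (z + (- h) * S) - (1ℚ + 1ℚ) * z ≡
                             1ℚ - ((h * (1ℚ + 1ℚ)) * S₀ + z)
      regroup = solve-∀ ℚ-ring

  -- by strong induction: the defect has derivative k · (defect of k - 1), hence is constant, and it vanishes at 0
  E-shift : ∀ k x → E k (x + 1ℚ) + E k x ≡ two * x ^ℚ k
  E-shift = <-rec _ step
    where
    step : ∀ k → (∀ {i} → i ℕ.< k → ∀ x → E i (x + 1ℚ) + E i x ≡ two * x ^ℚ i) →
           ∀ x → E k (x + 1ℚ) + E k x ≡ two * x ^ℚ k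
    step k IH x = x-y≡0⇒x≡y _ _ (begin
      E k (x + 1ℚ) + E k x - two * x ^ℚ k   ≡⟨ sym (eval-shift-defect k x) ⟩
      eval (shift-defect k) x               ≡⟨ deriv≡0⇒constant (shift-defect k) (defect′≡0 k IH) x ⟩
      eval (shift-defect k) 0ℚ              ≡⟨ eval-shift-defect k 0ℚ ⟩
      E k (0ℚ + 1ℚ) + E k 0ℚ - two * 0ℚ ^ℚ k ≡⟨ cong (λ y → E k y + E k 0ℚ - two * 0ℚ ^ℚ k) (+-identityˡ 1ℚ) ⟩
      E k 1ℚ + E k 0ℚ - two * 0ℚ ^ℚ k       ≡⟨ cong (_- two * 0ℚ ^ℚ k) (E[1]+E[0] k IH-at-0) ⟩
      two * 0ℚ ^ℚ k - two * 0ℚ ^ℚ k         ≡⟨ +-inverseʳ (two * 0ℚ ^ℚ k) ⟩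
      0ℚ                                    ∎)
      where
      IH-at-0 : ∀ {i} → i ℕ.< k → E i 1ℚ + E i 0ℚ ≡ two * 0ℚ ^ℚ i
      IH-at-0 {i} i<k = trans (cong (λ y → E i y + E i 0ℚ) (sym (+-identityˡ 1ℚ))) (IH i<k 0ℚ)
      defect′≡0 : ∀ k → (∀ {i} → i ℕ.< k → ∀ x → E i (x + 1ℚ) + E i x ≡ two * x ^ℚ i) →
                  ∀ y → eval (deriv (shift-defect k)) y ≡ 0ℚ
      defect′≡0 zero    IH y = eval-deriv-shift-defect-0 y
      defect′≡0 (suc k) IH y = begin
        eval (deriv (shift-defect (suc k))) y            ≡⟨ eval-deriv-shift-defect k y ⟩
        ℕ→ℚ (suc k) * eval (shift-defect k) y            ≡⟨ cong (ℕ→ℚ (suc k) *_) (eval-shift-defect k y) ⟩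
        ℕ→ℚ (suc k) * (E k (y + 1ℚ) + E k y - two * y ^ℚ k) ≡⟨ cong (λ z → ℕ→ℚ (suc k) * (z - two * y ^ℚ k)) (IH (ℕ.n<1+n k) y) ⟩
        ℕ→ℚ (suc k) * (two * y ^ℚ k - two * y ^ℚ k)      ≡⟨ cong (ℕ→ℚ (suc k) *_) (+-inverseʳ (two * y ^ℚ k)) ⟩
        ℕ→ℚ (suc k) * 0ℚ                                 ≡⟨ *-zeroʳ (ℕ→ℚ (suc k)) ⟩
        0ℚ                                               ∎

  E[1] : ∀ m → E (suc m) 1ℚ ≡ - E (suc m) 0ℚ
  E[1] m = x+y≡0⇒x≡-y _ _ (begin
    E (suc m) 1ℚ + E (suc m) 0ℚ            ≡⟨ cong (λ t → E (suc m) t + E (suc m) 0ℚ) (sym (+-identityˡ 1ℚ)) ⟩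
    E (suc m) (0ℚ + 1ℚ) + E (suc m) 0ℚ     ≡⟨ E-shift (suc m) 0ℚ ⟩
    two * 0ℚ ^ℚ suc m                     ≡⟨ cong (two *_) (0^suc m) ⟩
    two * 0ℚ                              ≡⟨ *-zeroʳ two ⟩
    0ℚ                                    ∎)

  private
    module Multiplication (M m : ℕ) (odd : suc m % 2 ≡ 1) where
      ρ : ℚ
      ρ = recip (suc m)
      mᴹ : ℚ
      mᴹ = ℕ→ℚ (suc m) ^ℚ M
      h : ℚ → ℕ → ℚ
      h y r = sgnℕ r * E M ((y + ℕ→ℚ r) * ρ)
      term : ℕ → Poly
      term r = scaleₚ (sgnℕ r) (comp (EulerPoly M) (lin ρ (ℕ→ℚ r * ρ)))
      Q : Poly
      Q = scaleₚ mᴹ (Σₚ (suc m) term) -ₚ EulerPoly M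
      eval-Q : ∀ y → eval Q y ≡ mᴹ * ∑ (suc m) (h y) - E M y
      eval-Q y = begin
        eval Q y
          ≡⟨ eval-subₚ (scaleₚ mᴹ (Σₚ (suc m) term)) (EulerPoly M) y ⟩
        eval (scaleₚ mᴹ (Σₚ (suc m) term)) y - E M y
          ≡⟨ cong (_- E M y) (eval-scaleₚ mᴹ (Σₚ (suc m) term) y) ⟩
        mᴹ * eval (Σₚ (suc m) term) y - E M y
          ≡⟨ cong (λ t → mᴹ * t - E M y) (trans (eval-Σₚ (suc m) term y) (∑-cong (suc m) eval-term)) ⟩
        mᴹ * ∑ (suc m) (h y) - E M y
          ∎
        where
        eval-term : ∀ r → eval (term r) y ≡ h y r
        eval-term r = trans (eval-scaleₚ (sgnℕ r) (comp (EulerPoly M) (lin ρ (ℕ→ℚ r * ρ))) y) (cong (sgnℕ r *_)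
          (trans (eval-comp (EulerPoly M) (lin ρ (ℕ→ℚ r * ρ)) y) (cong (E M) (trans (eval-lin ρ (ℕ→ℚ r * ρ) y) (factor ρ y (ℕ→ℚ r))))))
          where
          factor : ∀ ρ y r → ρ * y + r * ρ ≡ (y + r) * ρ
          factor = solve-∀ ℚ-ring
      h-shift : ∀ y r → h (y + 1ℚ) r + h y r ≡ - (h y (suc r) - h y r)
      h-shift y r = begin
        sgnℕ r * E M ((y + 1ℚ + ℕ→ℚ r) * ρ) + h y r
          ≡⟨ cong (λ t → sgnℕ r * E M (t * ρ) + h y r) (trans (+-assoc y 1ℚ (ℕ→ℚ r)) (cong (y +_) (sym (ℕ→ℚ-suc r)))) ⟩
        sgnℕ r * E M ((y + ℕ→ℚ (suc r)) * ρ) + h y r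
          ≡⟨ regroup (sgnℕ r) (E M ((y + ℕ→ℚ (suc r)) * ρ)) (h y r) ⟩
        - ((- sgnℕ r) * E M ((y + ℕ→ℚ (suc r)) * ρ) - h y r)
          ∎
        where
        regroup : ∀ s e c → s * e + c ≡ - ((- s) * e - c)
        regroup = solve-∀ ℚ-ring
      ∑-h-shift : ∀ y → ∑ (suc m) (h (y + 1ℚ)) + ∑ (suc m) (h y) ≡ two * (y * ρ) ^ℚ M
      ∑-h-shift y = begin
        ∑ (suc m) (h (y + 1ℚ)) + ∑ (suc m) (h y)           ≡⟨ sym (∑-distrib-+ (suc m) (h (y + 1ℚ)) (h y)) ⟩
        ∑ (suc m) (λ r → h (y + 1ℚ) r + h y r)             ≡⟨ ∑-cong (suc m) (h-shift y) ⟩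
        ∑ (suc m) (λ r → - (h y (suc r) - h y r))          ≡⟨ ∑-neg (suc m) (λ r → h y (suc r) - h y r) ⟩
        - ∑ (suc m) (λ r → h y (suc r) - h y r)            ≡⟨ cong -_ (∑-telescope (suc m) (h y)) ⟩
        - (h y (suc m) - h y 0)                            ≡⟨ cong₂ (λ s t → - (s * E M ((y + ℕ→ℚ (suc m)) * ρ) - t))
                                                                     (sgnℕ-odd (suc m) odd) (*-identityˡ (E M ((y + 0ℚ) * ρ))) ⟩
        - ((- 1ℚ) * E M ((y + ℕ→ℚ (suc m)) * ρ) - E M ((y + 0ℚ) * ρ))
                                                           ≡⟨ cong₂ (λ s t → - ((- 1ℚ) * E M s - E M t))
                                                                     (trans (*-distribʳ-+ ρ y (ℕ→ℚ (suc m))) (cong (y * ρ +_) (recip-inverseʳ m)))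
                                                                     (cong (_* ρ) (+-identityʳ y)) ⟩
        - ((- 1ℚ) * E M (y * ρ + 1ℚ) - E M (y * ρ))          ≡⟨ simplify (E M (y * ρ + 1ℚ)) (E M (y * ρ)) ⟩
        E M (y * ρ + 1ℚ) + E M (y * ρ)                       ≡⟨ E-shift M (y * ρ) ⟩
        two * (y * ρ) ^ℚ M                                   ∎
        where
        simplify : ∀ a b → - ((- 1ℚ) * a - b) ≡ a + b
        simplify = solve-∀ ℚ-ring
      Q-antiperiodic : ∀ y → eval Q (y + 1ℚ) + eval Q y ≡ 0ℚ
      Q-antiperiodic y = begin
        eval Q (y + 1ℚ) + eval Q y
          ≡⟨ cong₂ _+_ (eval-Q (y + 1ℚ)) (eval-Q y) ⟩
        (mᴹ * ∑ (suc m) (h (y + 1ℚ)) - E M (y + 1ℚ)) + (mᴹ * ∑ (suc m) (h y) - E M y)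
          ≡⟨ regroup mᴹ (∑ (suc m) (h (y + 1ℚ))) (∑ (suc m) (h y)) (E M (y + 1ℚ)) (E M y) ⟩
        mᴹ * (∑ (suc m) (h (y + 1ℚ)) + ∑ (suc m) (h y)) - (E M (y + 1ℚ) + E M y)
          ≡⟨ cong₂ (λ s t → mᴹ * s - t) (∑-h-shift y) (E-shift M y) ⟩
        mᴹ * (two * (y * ρ) ^ℚ M) - two * y ^ℚ M
          ≡⟨ cong (_- two * y ^ℚ M) (trans (commute mᴹ two _) (cong (two *_) (sym (^ℚ-distribʳ-* (ℕ→ℚ (suc m)) (y * ρ) M)))) ⟩
        two * (ℕ→ℚ (suc m) * (y * ρ)) ^ℚ M - two * y ^ℚ M
          ≡⟨ cong (λ t → two * t ^ℚ M - two * y ^ℚ M)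
               (trans (cancel (ℕ→ℚ (suc m)) y ρ) (trans (cong (y *_) (recip-inverseʳ m)) (*-identityʳ y))) ⟩
        two * y ^ℚ M - two * y ^ℚ M
          ≡⟨ +-inverseʳ (two * y ^ℚ M) ⟩
        0ℚ
          ∎
        where
        regroup : ∀ B a c d e → (B * a - d) + (B * c - e) ≡ B * (a + c) - (d + e)
        regroup = solve-∀ ℚ-ring
        commute : ∀ B t p → B * (t * p) ≡ t * (B * p)
        commute = solve-∀ ℚ-ring
        cancel : ∀ n y ρ → n * (y * ρ) ≡ y * (n * ρ)
        cancel = solve-∀ ℚ-ring

  -- With n = m + 1 odd, Q(y) = n^M Σ_{r<n} (-1)^r E_M((y + r)/n) - E_M(y) is a polynomial with
  -- Q(y + 1) = - Q(y) (by E-shift and telescoping), hence Q = 0.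
  E-multiplication : ∀ M m → suc m % 2 ≡ 1 → ∀ y →
    ℕ→ℚ (suc m) ^ℚ M * ∑ (suc m) (λ r → sgnℕ r * E M ((y + ℕ→ℚ r) * recip (suc m))) ≡ E M y
  E-multiplication M m odd y = x-y≡0⇒x≡y _ _ (trans (sym (eval-Q y)) (antiperiodic⇒≡0 Q Q-antiperiodic y))
    where open Multiplication M m odd

  signed-Euler-sum : ∀ M m → suc m % 2 ≡ 1 → ∑ (suc m) (λ r → sgnℕ r * E M (r ÷ suc m)) ≡ recip (suc m) ^ℚ M * E M 0ℚ
  signed-Euler-sum M m odd = begin
    S                                         ≡⟨ sym (*-identityˡ S) ⟩
    1ℚ * S                                    ≡⟨ cong (_* S) (sym (trans (cong (_^ℚ M) (trans (*-comm ρ m′) (recip-inverseʳ m))) (1^ M))) ⟩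
    (ρ * m′) ^ℚ M * S                         ≡⟨ cong (_* S) (^ℚ-distribʳ-* ρ m′ M) ⟩
    ρ ^ℚ M * m′ ^ℚ M * S                      ≡⟨ *-assoc (ρ ^ℚ M) (m′ ^ℚ M) S ⟩
    ρ ^ℚ M * (m′ ^ℚ M * S)                    ≡⟨ cong (λ z → ρ ^ℚ M * (m′ ^ℚ M * z))
                                                      (∑-cong (suc m) (λ r → cong (λ y → sgnℕ r * E M (y * ρ)) (sym (+-identityˡ (ℕ→ℚ r))))) ⟩
    ρ ^ℚ M * (m′ ^ℚ M * ∑ (suc m) (λ r → sgnℕ r * E M ((0ℚ + ℕ→ℚ r) * ρ)))
                                              ≡⟨ cong (ρ ^ℚ M *_) (E-multiplication M m odd 0ℚ) ⟩
    ρ ^ℚ M * E M 0ℚ                           ∎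
    where
    ρ  = recip (suc m)
    m′ = ℕ→ℚ (suc m)
    S  = ∑ (suc m) (λ r → sgnℕ r * E M (r ÷ suc m))

module ModularPermutation where

  open import Data.Nat as ℕ using (ℕ; zero; suc; NonZero; _∸_)
  import Data.Nat.Properties as ℕ
  open import Data.Nat.DivMod using (_/_; _%_; m≡m%n+[m/n]*n; m%n<n)
  open import Data.Nat.Divisibility using (_∣_; divides; ∣⇒≤)
  open import Data.Nat.Coprimality using (Coprime; coprime-divisor)
  import Data.Nat.Coprimality as Coprimality
  open import Data.Fin as Fin using (Fin; toℕ; fromℕ<; punchOut)
  open import Data.Fin.Properties using (any?; punchOut-injective; injective⇒≤; toℕ-fromℕ<; toℕ-injective; toℕ<n)
  open import Data.Fin.Permutation using (Permutation; permutation)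
  open import Data.Rational using (ℚ; _+_)
  open import Data.Rational.Properties using (+-0-commutativeMonoid)
  import Algebra.Properties.CommutativeMonoid.Sum as MonoidSum
  open import Data.Empty using (⊥-elim)
  open import Data.Product using (Σ; _,_; proj₁; proj₂)
  open import Function.Definitions using (Injective)
  open import Relation.Nullary using (yes; no)
  open import Relation.Binary.PropositionalEquality
  open Summation
  open ≡-Reasoning

  private
    module FinSum = MonoidSum +-0-commutativeMonoid

    ∑≡sum : ∀ n (h : ℕ → ℚ) → ∑ n h ≡ FinSum.sum (λ (i : Fin n) → h (toℕ i))
    ∑≡sum zero    h = refl
    ∑≡sum (suc n) h = cong (h 0 +_) (∑≡sum n (λ i → h (suc i)))

    injective⇒surjective : ∀ {n} (f : Fin n → Fin n) → Injective _≡_ _≡_ f → ∀ y → Σ (Fin n) (λ x → f x ≡ y)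
    injective⇒surjective {n} f f-inj y with any? (λ x → f x Fin.≟ y)
    ... | yes hit = hit
    injective⇒surjective {suc n} f f-inj y | no miss = ⊥-elim (ℕ.<-irrefl refl (injective⇒≤ g-inj))
      where
      y≢f : ∀ x → y ≢ f x
      y≢f x y≡fx = miss (x , sym y≡fx)
      g : Fin (suc n) → Fin n
      g x = punchOut (y≢f x)
      g-inj : Injective _≡_ _≡_ g
      g-inj {x} {z} gx≡gz = f-inj (punchOut-injective (y≢f x) (y≢f z) gx≡gz)

    sum-injective : ∀ {n} (f : Fin n → Fin n) → Injective _≡_ _≡_ f → (v : Fin n → ℚ) → FinSum.sum v ≡ FinSum.sum (λ i → v (f i))
    sum-injective {n} f f-inj v = FinSum.sum-permute v π
      where
      f⁻¹ : Fin n → Fin n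
      f⁻¹ y = proj₁ (injective⇒surjective f f-inj y)
      π : Permutation n n
      π = permutation f f⁻¹ (λ y → proj₂ (injective⇒surjective f f-inj y)) (λ x → f-inj (proj₂ (injective⇒surjective f f-inj (f x))))

  b∣[j∸i] : ∀ a b .{{_ : NonZero b}} → Coprime b a → ∀ i j → (i ℕ.* a) % b ≡ (j ℕ.* a) % b → b ∣ j ∸ i
  b∣[j∸i] a b b⊥a i j ia≡ja = coprime-divisor b⊥a (divides (qj ∸ qi) (trans (ℕ.*-comm a (j ∸ i)) [j∸i]*a≡[qj∸qi]*b))
    where
    qi = (i ℕ.* a) / b
    qj = (j ℕ.* a) / b
    r  = (i ℕ.* a) % b
    [j∸i]*a≡[qj∸qi]*b : (j ∸ i) ℕ.* a ≡ (qj ∸ qi) ℕ.* b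
    [j∸i]*a≡[qj∸qi]*b = begin
      (j ∸ i) ℕ.* a                                  ≡⟨ ℕ.*-distribʳ-∸ a j i ⟩
      j ℕ.* a ∸ i ℕ.* a                              ≡⟨ cong₂ _∸_ (trans (m≡m%n+[m/n]*n (j ℕ.* a) b) (cong (ℕ._+ qj ℕ.* b) (sym ia≡ja)))
                                                                  (m≡m%n+[m/n]*n (i ℕ.* a) b) ⟩
      (r ℕ.+ qj ℕ.* b) ∸ (r ℕ.+ qi ℕ.* b)            ≡⟨ ℕ.[m+n]∸[m+o]≡n∸o r (qj ℕ.* b) (qi ℕ.* b) ⟩
      qj ℕ.* b ∸ qi ℕ.* b                            ≡⟨ sym (ℕ.*-distribʳ-∸ b qj qi) ⟩
      (qj ∸ qi) ℕ.* b                                ∎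

  *%-injective : ∀ a b .{{_ : NonZero b}} → Coprime b a → ∀ {i j} → i ℕ.< b → j ℕ.< b →
                 (i ℕ.* a) % b ≡ (j ℕ.* a) % b → i ≡ j
  *%-injective a b b⊥a {i} {j} i<b j<b ia≡ja =
    ℕ.≤-antisym (ℕ.m∸n≡0⇒m≤n (small⇒zero (b∣[j∸i] a b b⊥a j i (sym ia≡ja)) (ℕ.≤-<-trans (ℕ.m∸n≤m i j) i<b)))
                (ℕ.m∸n≡0⇒m≤n (small⇒zero (b∣[j∸i] a b b⊥a i j ia≡ja) (ℕ.≤-<-trans (ℕ.m∸n≤m j i) j<b)))
    where
    small⇒zero : ∀ {d} → b ∣ d → d ℕ.< b → d ≡ 0
    small⇒zero {zero}  _   _   = refl
    small⇒zero {suc d} b∣d d<b = ⊥-elim (ℕ.<-irrefl refl (ℕ.<-≤-trans d<b (∣⇒≤ b∣d)))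

  ∑-*% : ∀ a b → Coprime a (suc b) → (h : ℕ → ℚ) → ∑ (suc b) (λ j → h ((j ℕ.* a) % suc b)) ≡ ∑ (suc b) h
  ∑-*% a b a⊥b h = begin
    ∑ (suc b) (λ j → h ((j ℕ.* a) % suc b))
      ≡⟨ ∑≡sum (suc b) (λ j → h ((j ℕ.* a) % suc b)) ⟩
    FinSum.sum {suc b} (λ i → h ((toℕ i ℕ.* a) % suc b))
      ≡⟨ FinSum.sum-cong-≗ {suc b} (λ i → cong h (sym (toℕ-fromℕ< (m%n<n (toℕ i ℕ.* a) (suc b))))) ⟩
    FinSum.sum {suc b} (λ i → h (toℕ (σ i)))
      ≡⟨ sym (sum-injective σ σ-injective (λ i → h (toℕ i))) ⟩
    FinSum.sum {suc b} (λ i → h (toℕ i))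
      ≡⟨ sym (∑≡sum (suc b) h) ⟩
    ∑ (suc b) h
      ∎
    where
    σ : Fin (suc b) → Fin (suc b)
    σ j = fromℕ< (m%n<n (toℕ j ℕ.* a) (suc b))
    σ-injective : Injective _≡_ _≡_ σ
    σ-injective {x} {y} σx≡σy = toℕ-injective (*%-injective a (suc b) (Coprimality.sym a⊥b) (toℕ<n x) (toℕ<n y)
      (trans (sym (toℕ-fromℕ< (m%n<n (toℕ x ℕ.* a) (suc b)))) (trans (cong toℕ σx≡σy) (toℕ-fromℕ< (m%n<n (toℕ y ℕ.* a) (suc b))))))

module QuasiPeriodicEuler where

  open import Data.Nat as ℕ using (ℕ; suc)
  import Data.Nat.Properties as ℕ
  open import Data.Nat.DivMod using (_/_; _%_; m≡m%n+[m/n]*n; m%n<n; m*n/n≡m; m/n*n≤m; m<n*o⇒m/o<n; /-mono-≤)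
  open import Data.Integer as ℤ using (+_; -[1+_])
  import Data.Integer.Properties as ℤ
  open import Data.Rational as ℚ using (ℚ; 0ℚ; 1ℚ; _+_; _*_; _-_; -_; _<_; _≤_; mkℚ; floor)
  open import Data.Rational.Properties
  open import Data.Empty using (⊥; ⊥-elim)
  open import Data.Product using (_,_; proj₁)
  open import Data.Sum using (inj₁; inj₂)
  open import Relation.Binary.PropositionalEquality
  open import Tactic.RingSolver using (solve-∀)
  open import Defs
  open Arithmetic
  open Polynomial
  open EulerPolynomial
  open ≡-Reasoning

  floor-unique : ∀ y q → ℕ→ℚ q ≤ y → y < ℕ→ℚ (suc q) → floor y ≡ + q
  floor-unique y@(mkℚ (+ m) d _) q q≤y y<q+1 = trans (ℤ.*-identityˡ (+ (m / suc d))) (cong +_ (ℕ.≤-antisym m/d≤q q≤m/d))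
    where
    qd≤m : q ℕ.* suc d ℕ.≤ m
    qd≤m = ℤ.drop‿+≤+ (subst₂ ℤ._≤_ (sym (ℤ.pos-* q (suc d))) (ℤ.*-identityʳ (+ m)) (drop-*≤* (subst (_≤ y) (ℕ→ℚ≡mkℚ q) q≤y)))
    m<[q+1]d : m ℕ.< suc q ℕ.* suc d
    m<[q+1]d = ℤ.drop‿+<+ (subst₂ ℤ._<_ (ℤ.*-identityʳ (+ m)) (sym (ℤ.pos-* (suc q) (suc d)))
                                    (drop-*<* (subst (y <_) (ℕ→ℚ≡mkℚ (suc q)) y<q+1)))
    m/d≤q : m / suc d ℕ.≤ q
    m/d≤q = ℕ.<⇒≤pred (m<n*o⇒m/o<n m<[q+1]d)
    q≤m/d : q ℕ.≤ m / suc d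
    q≤m/d = subst (ℕ._≤ m / suc d) (m*n/n≡m q (suc d)) (/-mono-≤ qd≤m ℕ.≤-refl)
  floor-unique y@(mkℚ -[1+ m ] d _) q q≤y y<q+1 =
    ⊥-elim (+≰-[1+m] (subst₂ ℤ._≤_ (sym (ℤ.pos-* q (suc d))) (ℤ.*-identityʳ -[1+ m ]) (drop-*≤* (subst (_≤ y) (ℕ→ℚ≡mkℚ q) q≤y))))
    where
    +≰-[1+m] : ∀ {k} → + k ℤ.≤ -[1+ m ] → ⊥
    +≰-[1+m] ()

  -- the branch of x ↦ Ē_m(A x) where ⌊A x⌋ = q
  Ē-piece : ℚ → ℕ → ℕ → Poly
  Ē-piece A q m = scaleₚ (sgnℕ q) (comp (EulerPoly m) (lin A (- ℕ→ℚ q)))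

  eval-Ē-piece : ∀ A q m x → eval (Ē-piece A q m) x ≡ sgnℕ q * E m (A * x - ℕ→ℚ q)
  eval-Ē-piece A q m x = trans (eval-scaleₚ (sgnℕ q) (comp (EulerPoly m) (lin A (- ℕ→ℚ q))) x)
    (cong (sgnℕ q *_) (trans (eval-comp (EulerPoly m) (lin A (- ℕ→ℚ q)) x) (cong (E m) (eval-lin A (- ℕ→ℚ q) x))))

  eval-deriv-Ē-piece : ∀ A q m x → eval (deriv (Ē-piece A q (suc m))) x ≡ A * ℕ→ℚ (suc m) * eval (Ē-piece A q m) x
  eval-deriv-Ē-piece A q m x = begin
    eval (deriv (scaleₚ (sgnℕ q) (comp (EulerPoly (suc m)) L))) x
      ≡⟨ eval-deriv-scaleₚ (sgnℕ q) (comp (EulerPoly (suc m)) L) x ⟩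
    sgnℕ q * eval (deriv (comp (EulerPoly (suc m)) L)) x
      ≡⟨ cong (sgnℕ q *_) (eval-deriv-comp (EulerPoly (suc m)) L x) ⟩
    sgnℕ q * (eval (deriv L) x * eval (deriv (EulerPoly (suc m))) (eval L x))
      ≡⟨ cong₂ (λ u w → sgnℕ q * (u * w)) (eval-deriv-lin A (- ℕ→ℚ q) x) (eval-deriv-EulerPoly m (eval L x)) ⟩
    sgnℕ q * (A * (ℕ→ℚ (suc m) * E m (eval L x)))
      ≡⟨ regroup (sgnℕ q) A (ℕ→ℚ (suc m)) (E m (eval L x)) ⟩
    A * ℕ→ℚ (suc m) * (sgnℕ q * E m (eval L x))
      ≡⟨ cong (A * ℕ→ℚ (suc m) *_)
           (sym (trans (eval-scaleₚ (sgnℕ q) (comp (EulerPoly m) L) x) (cong (sgnℕ q *_) (eval-comp (EulerPoly m) L x)))) ⟩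
    A * ℕ→ℚ (suc m) * eval (Ē-piece A q m) x
      ∎
    where
    L = lin A (- ℕ→ℚ q)
    regroup : ∀ s A K e → s * (A * (K * e)) ≡ A * K * (s * e)
    regroup = solve-∀ ℚ-ring

  Ebar≡Ē-piece : ∀ A q m x → floor (A * x) ≡ + q → Ebar m (A * x) ≡ eval (Ē-piece A q m) x
  Ebar≡Ē-piece A q m x ⌊Ax⌋≡q = trans (cong (λ z → sgnℤ z * E m (A * x - (z ℚ./ 1))) ⌊Ax⌋≡q) (sym (eval-Ē-piece A q m x))

  floor-on-cell : ∀ A {{_ : ℚ.Positive A}} d (T : ℕ → ℚ) → (∀ u → A * T u ≡ u ÷ suc d) →
                  ∀ c x → T c < x → x < T (suc c) → floor (A * x) ≡ + (c / suc d)
  floor-on-cell A d T A*T c x Tc<x x<Tc+1 = floor-unique (A * x) q (<⇒≤ q<Ax) Ax<q+1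
    where
    q = c / suc d
    q<Ax : ℕ→ℚ q < A * x
    q<Ax = ≤-<-trans (subst (_≤ c ÷ suc d) (*÷-cancelʳ q d) (÷-mono-≤ d (m/n*n≤m c (suc d))))
                     (subst (_< A * x) (A*T c) (*-monoʳ-<-pos A Tc<x))
    Ax<q+1 : A * x < ℕ→ℚ (suc q)
    Ax<q+1 = <-≤-trans (subst (A * x <_) (A*T (suc c)) (*-monoʳ-<-pos A x<Tc+1))
                       (subst (suc c ÷ suc d ≤_) (*÷-cancelʳ (suc q) d) (÷-mono-≤ d (m<[1+m/n]*n c (suc d))))

  -- branch-at d m q u is the branch (-1)^q E_m(x - q) at x = u/(d+1), and Ē-at d m u is Ē_m(u/(d+1))
  branch-at : ℕ → ℕ → ℕ → ℕ → ℚ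
  branch-at d m q u = sgnℕ q * E m (u ÷ suc d - ℕ→ℚ q)

  Ē-at : ℕ → ℕ → ℕ → ℚ
  Ē-at d m u = branch-at d m (u / suc d) u

  eval-Ē-piece-on-grid : ∀ A q m d (T : ℕ → ℚ) → (∀ u → A * T u ≡ u ÷ suc d) → ∀ u → eval (Ē-piece A q m) (T u) ≡ branch-at d m q u
  eval-Ē-piece-on-grid A q m d T A*T u = trans (eval-Ē-piece A q m (T u)) (cong (λ z → sgnℕ q * E m (z - ℕ→ℚ q)) (A*T u))

  branch-at-multiple : ∀ d m q k → branch-at d m q (k ℕ.* suc d) ≡ sgnℕ q * E m (ℕ→ℚ k - ℕ→ℚ q)
  branch-at-multiple d m q k = cong (λ z → sgnℕ q * E m (z - ℕ→ℚ q)) (*÷-cancelʳ k d)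

  Ē-at-multiple : ∀ d m k → Ē-at d m (k ℕ.* suc d) ≡ sgnℕ k * E m 0ℚ
  Ē-at-multiple d m k = begin
    branch-at d m ((k ℕ.* suc d) / suc d) (k ℕ.* suc d)   ≡⟨ cong (λ q → branch-at d m q (k ℕ.* suc d)) (m*n/n≡m k (suc d)) ⟩
    branch-at d m k (k ℕ.* suc d)                         ≡⟨ branch-at-multiple d m k k ⟩
    sgnℕ k * E m (ℕ→ℚ k - ℕ→ℚ k)                          ≡⟨ cong (λ z → sgnℕ k * E m z) (+-inverseʳ (ℕ→ℚ k)) ⟩
    sgnℕ k * E m 0ℚ                                       ∎

  -- Ē_{m+1} is continuous: E_{m+1}(1) = - E_{m+1}(0) matches the branches at the integers
  branch-at-right-end : ∀ d m c → branch-at d (suc m) (c / suc d) (suc c) ≡ Ē-at d (suc m) (suc c)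
  branch-at-right-end d m c with ℕ.m≤n⇒m<n∨m≡n (m%n<n c (suc d))
  ... | inj₁ [c%D]+1<D = cong (λ q → branch-at d (suc m) q (suc c))
          (sym (proj₁ (divMod-unique (suc c) (c / suc d) (suc (c % suc d)) (suc d) [c%D]+1<D (cong suc (m≡m%n+[m/n]*n c (suc d))))))
  ... | inj₂ [c%D]+1≡D = begin
    branch-at d (suc m) q (suc c)                 ≡⟨ cong (branch-at d (suc m) q) c+1≡[q+1]D ⟩
    branch-at d (suc m) q (suc q ℕ.* suc d)       ≡⟨ branch-at-multiple d (suc m) q (suc q) ⟩
    sgnℕ q * E (suc m) (ℕ→ℚ (suc q) - ℕ→ℚ q)      ≡⟨ cong (λ z → sgnℕ q * E (suc m) (z - ℕ→ℚ q)) (ℕ→ℚ-suc q) ⟩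
    sgnℕ q * E (suc m) (1ℚ + ℕ→ℚ q - ℕ→ℚ q)       ≡⟨ cong (λ z → sgnℕ q * E (suc m) z) (cancel 1ℚ (ℕ→ℚ q)) ⟩
    sgnℕ q * E (suc m) 1ℚ                         ≡⟨ cong (sgnℕ q *_) (E[1] m) ⟩
    sgnℕ q * - E (suc m) 0ℚ                       ≡⟨ trans (sym (neg-distribʳ-* (sgnℕ q) _)) (neg-distribˡ-* (sgnℕ q) _) ⟩
    sgnℕ (suc q) * E (suc m) 0ℚ                   ≡⟨ sym (Ē-at-multiple d (suc m) (suc q)) ⟩
    Ē-at d (suc m) (suc q ℕ.* suc d)              ≡⟨ cong (Ē-at d (suc m)) (sym c+1≡[q+1]D) ⟩
    Ē-at d (suc m) (suc c)                        ∎
    where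
    q = c / suc d
    c+1≡[q+1]D : suc c ≡ suc q ℕ.* suc d
    c+1≡[q+1]D = trans (cong suc (m≡m%n+[m/n]*n c (suc d))) (cong (ℕ._+ q ℕ.* suc d) [c%D]+1≡D)
    cancel : ∀ x y → x + y - y ≡ x
    cancel = solve-∀ ℚ-ring

module ProductIntegral (a′ b′ : ℕ) where

  open import Data.Nat as ℕ using (ℕ; zero; suc)
  import Data.Nat.Properties as ℕ
  open import Data.Nat.DivMod using (_/_; _%_)
  open import Data.Nat.Coprimality using (Coprime)
  open import Data.Nat.Combinatorics using (_C_; nC1≡n)
  import Data.Nat.Tactic.RingSolver as ℕ-Solver
  open import Data.Rational as ℚ using (ℚ; 0ℚ; 1ℚ; _+_; _*_; _-_; -_; _<_)
  open import Data.Rational.Properties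
  open import Relation.Binary.PropositionalEquality
  open import Tactic.RingSolver using (solve-∀)
  open import Defs
  open Arithmetic
  open Binomial
  open Summation
  open Polynomial
  open PolynomialFunction
  open PiecewiseIntegral
  open EulerPolynomial
  open ModularPermutation
  open QuasiPeriodicEuler
  open ≡-Reasoning

  a b N : ℕ
  a = suc a′
  b = suc b′
  N = a ℕ.* b

  A B : ℚ
  A = ℕ→ℚ a
  B = ℕ→ℚ b

  instance
    A-pos : ℚ.Positive A
    A-pos = ℕ→ℚ-pos a′
    B-pos : ℚ.Positive B
    B-pos = ℕ→ℚ-pos b′

  -- on the cells of this grid both ⌊a x⌋ and ⌊b x⌋ are constant
  t : ℕ → ℚ
  t u = u ÷ N

  A*t : ∀ u → A * t u ≡ u ÷ b
  A*t = m*[u÷m*n]≡u÷n a′ b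

  B*t : ∀ u → B * t u ≡ u ÷ a
  B*t u = trans (cong (λ k → B * (u ÷ k)) (ℕ.*-comm a b)) (m*[u÷m*n]≡u÷n b′ a u)

  Apiece Bpiece : ℕ → ℕ → Poly
  Apiece m c = Ē-piece A (c / b) m
  Bpiece m c = Ē-piece B (c / a) m

  product : ℕ → ℕ → ℚ → ℚ
  product p n x = Ebar p (A * x) * Ebar n (B * x)

  product-piecewise : ∀ p n → PiecewisePoly01 (product p n)
  product-piecewise p n = record
    { cells  = N
    ; piece  = λ c → Apiece p c *ₚ Bpiece n c
    ; agrees = λ c _ x lo hi →
        let tc<x   = subst (_< x) (+/≡÷ c N) lo
            x<tc+1 = subst (x <_) (+/≡÷ (suc c) N) hi
        in trans (cong₂ _*_ (Ebar≡Ē-piece A (c / b) p x (floor-on-cell A b′ t A*t c x tc<x x<tc+1))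
                            (Ebar≡Ē-piece B (c / a) n x (floor-on-cell B a′ t B*t c x tc<x x<tc+1)))
                 (sym (eval-*ₚ (Apiece p c) (Bpiece n c) x))
    }

  integral : ℕ → ℕ → ℚ
  integral p n = ∫₀¹ (product-piecewise p n)

  integral≡∑ : ∀ p n → integral p n ≡ ∑ N (λ c → ∫poly (Apiece p c *ₚ Bpiece n c) (t c) (t (suc c)))
  integral≡∑ p n = ∫₀¹≡∫grid (product-piecewise p n)

  Apiece-on-grid : ∀ m c u → eval (Apiece m c) (t u) ≡ branch-at b′ m (c / b) u
  Apiece-on-grid m c = eval-Ē-piece-on-grid A (c / b) m b′ t A*t

  Bpiece-on-grid : ∀ m c u → eval (Bpiece m c) (t u) ≡ branch-at a′ m (c / a) u
  Bpiece-on-grid m c = eval-Ē-piece-on-grid B (c / a) m a′ t B*t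

  κ : ℕ → ℕ → ℚ
  κ p n = (b ℕ.* suc n) ÷ (a ℕ.* suc p)

  ibp-primitive : ℕ → ℕ → ℕ → Poly
  ibp-primitive p n c = scaleₚ (recip (a ℕ.* suc p)) (Apiece (suc p) c *ₚ Bpiece (suc n) c)

  eval-deriv-ibp-primitive : ∀ p n c x → eval (deriv (ibp-primitive p n c)) x ≡
                             eval (Apiece p c *ₚ Bpiece (suc n) c) x + κ p n * eval (Apiece (suc p) c *ₚ Bpiece n c) x
  eval-deriv-ibp-primitive p n c x = begin
    eval (deriv (scaleₚ ρ (Apiece (suc p) c *ₚ Bpiece (suc n) c))) x
      ≡⟨ eval-deriv-scaleₚ ρ (Apiece (suc p) c *ₚ Bpiece (suc n) c) x ⟩
    ρ * eval (deriv (Apiece (suc p) c *ₚ Bpiece (suc n) c)) x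
      ≡⟨ cong (ρ *_) (eval-deriv-*ₚ (Apiece (suc p) c) (Bpiece (suc n) c) x) ⟩
    ρ * (eval (deriv (Apiece (suc p) c)) x * Bₙ₊₁ + Aₚ₊₁ * eval (deriv (Bpiece (suc n) c)) x)
      ≡⟨ cong₂ (λ u v → ρ * (u * Bₙ₊₁ + Aₚ₊₁ * v)) (eval-deriv-Ē-piece A (c / b) p x) (eval-deriv-Ē-piece B (c / a) n x) ⟩
    ρ * (A * P * Aₚ * Bₙ₊₁ + Aₚ₊₁ * (B * Q * Bₙ))
      ≡⟨ regroup ρ (A * P) Aₚ Bₙ₊₁ Aₚ₊₁ (B * Q) Bₙ ⟩
    A * P * ρ * (Aₚ * Bₙ₊₁) + B * Q * ρ * (Aₚ₊₁ * Bₙ)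
      ≡⟨ cong₂ (λ u v → u * ρ * (Aₚ * Bₙ₊₁) + v * ρ * (Aₚ₊₁ * Bₙ))
               (sym (ℕ→ℚ-homo-* a (suc p))) (sym (ℕ→ℚ-homo-* b (suc n))) ⟩
    ℕ→ℚ (a ℕ.* suc p) * ρ * (Aₚ * Bₙ₊₁) + κ p n * (Aₚ₊₁ * Bₙ)
      ≡⟨ cong (λ u → u * (Aₚ * Bₙ₊₁) + κ p n * (Aₚ₊₁ * Bₙ)) (recip-inverseʳ (p ℕ.+ a′ ℕ.* suc p)) ⟩
    1ℚ * (Aₚ * Bₙ₊₁) + κ p n * (Aₚ₊₁ * Bₙ)
      ≡⟨ cong₂ (λ u v → u + κ p n * v) (trans (*-identityˡ (Aₚ * Bₙ₊₁)) (sym (eval-*ₚ (Apiece p c) (Bpiece (suc n) c) x)))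
                                       (sym (eval-*ₚ (Apiece (suc p) c) (Bpiece n c) x)) ⟩
    eval (Apiece p c *ₚ Bpiece (suc n) c) x + κ p n * eval (Apiece (suc p) c *ₚ Bpiece n c) x
      ∎
    where
    ρ    = recip (a ℕ.* suc p)
    P    = ℕ→ℚ (suc p)
    Q    = ℕ→ℚ (suc n)
    Aₚ   = eval (Apiece p c) x
    Aₚ₊₁ = eval (Apiece (suc p) c) x
    Bₙ   = eval (Bpiece n c) x
    Bₙ₊₁ = eval (Bpiece (suc n) c) x
    regroup : ∀ ρ P X Y Z Q V → ρ * (P * X * Y + Z * (Q * V)) ≡ P * ρ * (X * Y) + Q * ρ * (Z * V)
    regroup = solve-∀ ℚ-ring

  ibp-boundary : ℕ → ℕ → ℕ → ℚ
  ibp-boundary p n u = recip (a ℕ.* suc p) * (Ē-at b′ (suc p) u * Ē-at a′ (suc n) u)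

  -- the primitives of neighbouring cells agree at the common grid point: Ē_{p+1} and Ē_{n+1} are continuous
  ibp-primitive-increment : ∀ p n c → eval (ibp-primitive p n c) (t (suc c)) - eval (ibp-primitive p n c) (t c) ≡
                                      ibp-boundary p n (suc c) - ibp-boundary p n c
  ibp-primitive-increment p n c =
    cong₂ _-_ (trans (on-grid (suc c)) (cong₂ (λ u v → ρ * (u * v)) (branch-at-right-end b′ p c) (branch-at-right-end a′ n c)))
              (on-grid c)
    where
    ρ = recip (a ℕ.* suc p)
    on-grid : ∀ u → eval (ibp-primitive p n c) (t u) ≡ ρ * (branch-at b′ (suc p) (c / b) u * branch-at a′ (suc n) (c / a) u)
    on-grid u = trans (eval-scaleₚ ρ (Apiece (suc p) c *ₚ Bpiece (suc n) c) (t u))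
      (cong (ρ *_) (trans (eval-*ₚ (Apiece (suc p) c) (Bpiece (suc n) c) (t u)) (cong₂ _*_ (Apiece-on-grid (suc p) c u) (Bpiece-on-grid (suc n) c u))))

  -- Ē_0(b x) is the constant (-1)^⌊c/a⌋ on cell c, so a primitive is a multiple of Ē_{m+1}(a x)
  base-cell : ∀ m c → ∫poly (Apiece m c *ₚ Bpiece 0 c) (t c) (t (suc c)) ≡
                      recip (a ℕ.* suc m) * (sgnℕ (c / a) * (Ē-at b′ (suc m) (suc c) - Ē-at b′ (suc m) c))
  base-cell m c = begin
    ∫poly (Apiece m c *ₚ Bpiece 0 c) (t c) (t (suc c))   ≡⟨ fundamental-theorem G (Apiece m c *ₚ Bpiece 0 c) G′ (t c) (t (suc c)) ⟩
    eval G (t (suc c)) - eval G (t c)                    ≡⟨ cong₂ _-_ (trans (on-grid (suc c)) (cong (ρ * s *_) (branch-at-right-end b′ m c)))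
                                                                      (on-grid c) ⟩
    ρ * s * w (suc c) - ρ * s * w c                      ≡⟨ factor ρ s (w (suc c)) (w c) ⟩
    ρ * (s * (w (suc c) - w c))                          ∎
    where
    ρ = recip (a ℕ.* suc m)
    s = sgnℕ (c / a)
    w = Ē-at b′ (suc m)
    G = scaleₚ (ρ * s) (Apiece (suc m) c)
    G′ : ∀ x → eval (deriv G) x ≡ eval (Apiece m c *ₚ Bpiece 0 c) x
    G′ x = begin
      eval (deriv G) x                           ≡⟨ eval-deriv-scaleₚ (ρ * s) (Apiece (suc m) c) x ⟩
      ρ * s * eval (deriv (Apiece (suc m) c)) x  ≡⟨ cong (ρ * s *_) (eval-deriv-Ē-piece A (c / b) m x) ⟩
      ρ * s * (A * ℕ→ℚ (suc m) * Aₘ)              ≡⟨ cong (λ z → ρ * s * (z * Aₘ)) (sym (ℕ→ℚ-homo-* a (suc m))) ⟩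
      ρ * s * (ℕ→ℚ (a ℕ.* suc m) * Aₘ)            ≡⟨ regroup ρ s (ℕ→ℚ (a ℕ.* suc m)) Aₘ ⟩
      ℕ→ℚ (a ℕ.* suc m) * ρ * (Aₘ * s)            ≡⟨ cong (_* (Aₘ * s)) (recip-inverseʳ (m ℕ.+ a′ ℕ.* suc m)) ⟩
      1ℚ * (Aₘ * s)                              ≡⟨ *-identityˡ (Aₘ * s) ⟩
      Aₘ * s                                     ≡⟨ cong (Aₘ *_) (sym B₀) ⟩
      Aₘ * eval (Bpiece 0 c) x                   ≡⟨ sym (eval-*ₚ (Apiece m c) (Bpiece 0 c) x) ⟩
      eval (Apiece m c *ₚ Bpiece 0 c) x          ∎
      where
      Aₘ = eval (Apiece m c) x
      B₀ : eval (Bpiece 0 c) x ≡ s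
      B₀ = trans (eval-Ē-piece B (c / a) 0 x) (trans (cong (s *_) (eval-const 1ℚ (B * x - ℕ→ℚ (c / a)))) (*-identityʳ s))
      regroup : ∀ ρ s P X → ρ * s * (P * X) ≡ P * ρ * (X * s)
      regroup = solve-∀ ℚ-ring
    on-grid : ∀ u → eval G (t u) ≡ ρ * s * branch-at b′ (suc m) (c / b) u
    on-grid u = trans (eval-scaleₚ (ρ * s) (Apiece (suc m) c) (t u)) (cong (ρ * s *_) (Apiece-on-grid (suc m) c u))
    factor : ∀ ρ s x y → ρ * s * x - ρ * s * y ≡ ρ * (s * (x - y))
    factor = solve-∀ ℚ-ring

  denominator : ℕ → ℕ → ℕ
  denominator p n = suc n ℕ.* (suc (p ℕ.+ n) C suc n) ℕ.* (a ℕ.^ suc n ℕ.* b ℕ.^ suc p)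

  closed-form : ℕ → ℕ → ℚ
  closed-form p n = two * sgnℕ (suc n) * recip (denominator p n) * E (suc (p ℕ.+ n)) 0ℚ

  closed-form-base : ∀ p → recip (a ℕ.* suc p) * - (two * (recip b ^ℚ suc p * E (suc p) 0ℚ)) ≡ closed-form p 0
  closed-form-base p = begin
    ρ * - (two * (recip b ^ℚ suc p * E (suc p) 0ℚ))
      ≡⟨ regroup ρ two (recip b ^ℚ suc p) (E (suc p) 0ℚ) ⟩
    two * (- 1ℚ) * (ρ * recip b ^ℚ suc p) * E (suc p) 0ℚ
      ≡⟨ cong₂ (λ r e → two * (- 1ℚ) * r * e)
           (sym (trans (cong recip denominator≡) (trans (recip-homo-* (a ℕ.* suc p) (b ℕ.^ suc p)) (cong (ρ *_) (recip-homo-^ b (suc p))))))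
           (cong (λ k → E (suc k) 0ℚ) (sym (ℕ.+-identityʳ p))) ⟩
    closed-form p 0
      ∎
    where
    ρ = recip (a ℕ.* suc p)
    denominator≡ : denominator p 0 ≡ a ℕ.* suc p ℕ.* b ℕ.^ suc p
    denominator≡ = begin
      1 ℕ.* (suc (p ℕ.+ 0) C 1) ℕ.* (a ℕ.* 1 ℕ.* bᵖ)   ≡⟨ cong (λ k → 1 ℕ.* (suc k C 1) ℕ.* (a ℕ.* 1 ℕ.* bᵖ)) (ℕ.+-identityʳ p) ⟩
      1 ℕ.* (suc p C 1) ℕ.* (a ℕ.* 1 ℕ.* bᵖ)          ≡⟨ cong (λ k → 1 ℕ.* k ℕ.* (a ℕ.* 1 ℕ.* bᵖ)) (nC1≡n (suc p)) ⟩
      1 ℕ.* suc p ℕ.* (a ℕ.* 1 ℕ.* bᵖ)                ≡⟨ rearrange (suc p) a bᵖ ⟩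
      a ℕ.* suc p ℕ.* bᵖ                              ∎
      where
      bᵖ = b ℕ.^ suc p
      rearrange : ∀ p a B → 1 ℕ.* p ℕ.* (a ℕ.* 1 ℕ.* B) ≡ a ℕ.* p ℕ.* B
      rearrange = ℕ-Solver.solve-∀
    regroup : ∀ ρ t r e → ρ * - (t * (r * e)) ≡ t * (- 1ℚ) * (ρ * r) * e
    regroup = solve-∀ ℚ-ring

  closed-form-step : ∀ p n → - (κ p n * closed-form (suc p) n) ≡ closed-form p (suc n)
  closed-form-step p n = begin
    - (ℕ→ℚ (b ℕ.* suc n) * recip (a ℕ.* suc p) * (two * s * recip D′ * e))
      ≡⟨ regroup (ℕ→ℚ (b ℕ.* suc n)) (recip (a ℕ.* suc p)) two s (recip D′) e ⟩
    two * (- s) * (ℕ→ℚ (b ℕ.* suc n) * (recip (a ℕ.* suc p) * recip D′)) * e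
      ≡⟨ cong (λ r → two * (- s) * (ℕ→ℚ (b ℕ.* suc n) * r) * e) (sym (recip-homo-* (a ℕ.* suc p) D′)) ⟩
    two * (- s) * (ℕ→ℚ (b ℕ.* suc n) * recip (a ℕ.* suc p ℕ.* D′)) * e
      ≡⟨ cong (λ k → two * (- s) * (ℕ→ℚ (b ℕ.* suc n) * recip k) * e) denominator-step ⟩
    two * (- s) * (ℕ→ℚ (b ℕ.* suc n) * recip (b ℕ.* suc n ℕ.* D)) * e
      ≡⟨ cong (λ r → two * (- s) * r * e) (m*recip[m*n]≡recip[n] (n ℕ.+ b′ ℕ.* suc n) D) ⟩
    two * (- s) * recip D * e
      ≡⟨ cong (λ k → two * (- s) * recip D * E (suc k) 0ℚ) (sym (ℕ.+-suc p n)) ⟩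
    closed-form p (suc n)
      ∎
    where
    s  = sgnℕ (suc n)
    e  = E (suc (suc p ℕ.+ n)) 0ℚ
    D  = denominator p (suc n)
    D′ = denominator (suc p) n
    T  = suc (suc (p ℕ.+ n))
    denominator-step : a ℕ.* suc p ℕ.* D′ ≡ b ℕ.* suc n ℕ.* D
    denominator-step = begin
      a ℕ.* suc p ℕ.* (suc n ℕ.* (T C suc n) ℕ.* (a ℕ.^ suc n ℕ.* b ℕ.^ suc (suc p)))
        ≡⟨ rearrange a b (suc p) (suc n) (T C suc n) (a ℕ.^ suc n) (b ℕ.^ suc p) ⟩
      b ℕ.* suc n ℕ.* (suc p ℕ.* (T C suc n) ℕ.* (a ℕ.^ suc (suc n) ℕ.* b ℕ.^ suc p))
        ≡⟨ cong (λ k → b ℕ.* suc n ℕ.* (k ℕ.* (a ℕ.^ suc (suc n) ℕ.* b ℕ.^ suc p)))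
             (sym (subst (λ k → suc (suc n) ℕ.* (suc k C suc (suc n)) ≡ suc p ℕ.* (suc k C suc n)) (ℕ.+-suc p n)
                         ([n+1]*[p+n+1]C[n+1]≡[p+1]*[p+n+1]Cn p (suc n)))) ⟩
      b ℕ.* suc n ℕ.* (suc (suc n) ℕ.* (T C suc (suc n)) ℕ.* (a ℕ.^ suc (suc n) ℕ.* b ℕ.^ suc p))
        ≡⟨ cong (λ k → b ℕ.* suc n ℕ.* (suc (suc n) ℕ.* (suc k C suc (suc n)) ℕ.* (a ℕ.^ suc (suc n) ℕ.* b ℕ.^ suc p))) (sym (ℕ.+-suc p n)) ⟩
      b ℕ.* suc n ℕ.* D
        ∎
      where
      rearrange : ∀ a b p n C X Y → a ℕ.* p ℕ.* (n ℕ.* C ℕ.* (X ℕ.* (b ℕ.* Y))) ≡ b ℕ.* n ℕ.* (p ℕ.* C ℕ.* (a ℕ.* X ℕ.* Y))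
      rearrange = ℕ-Solver.solve-∀
    regroup : ∀ B ρ t s r e → - (B * ρ * (t * s * r * e)) ≡ t * (- s) * (B * (ρ * r)) * e
    regroup = solve-∀ ℚ-ring

  module _ (a-odd : a % 2 ≡ 1) (b-odd : b % 2 ≡ 1) where

    -- the boundary terms left after telescoping cancel because a and b are odd
    integral-by-parts : ∀ p n → integral p (suc n) + κ p n * integral (suc p) n ≡ 0ℚ
    integral-by-parts p n = begin
      integral p (suc n) + κ p n * integral (suc p) n
        ≡⟨ cong₂ (λ u v → u + κ p n * v) (integral≡∑ p (suc n)) (integral≡∑ (suc p) n) ⟩
      ∑ N I₁ + κ p n * ∑ N I₂
        ≡⟨ cong (∑ N I₁ +_) (*-distribˡ-∑ N (κ p n) I₂) ⟩
      ∑ N I₁ + ∑ N (λ c → κ p n * I₂ c)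
        ≡⟨ sym (∑-distrib-+ N I₁ (λ c → κ p n * I₂ c)) ⟩
      ∑ N (λ c → I₁ c + κ p n * I₂ c)
        ≡⟨ ∑-cong N (λ c → trans (by-parts c) (ibp-primitive-increment p n c)) ⟩
      ∑ N (λ c → Φ (suc c) - Φ c)
        ≡⟨ ∑-telescope N Φ ⟩
      Φ N - Φ 0
        ≡⟨ cong₂ _-_ Φ[N] Φ[0] ⟩
      ρ * ((- 1ℚ) * e₁ * ((- 1ℚ) * e₂)) - ρ * (1ℚ * e₁ * (1ℚ * e₂))
        ≡⟨ cancel ρ e₁ e₂ ⟩
      0ℚ
        ∎
      where
      ρ  = recip (a ℕ.* suc p)
      e₁ = E (suc p) 0ℚ
      e₂ = E (suc n) 0ℚ
      Φ  = ibp-boundary p n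
      I₁ I₂ : ℕ → ℚ
      I₁ c = ∫poly (Apiece p c *ₚ Bpiece (suc n) c) (t c) (t (suc c))
      I₂ c = ∫poly (Apiece (suc p) c *ₚ Bpiece n c) (t c) (t (suc c))
      by-parts : ∀ c → I₁ c + κ p n * I₂ c ≡ eval (ibp-primitive p n c) (t (suc c)) - eval (ibp-primitive p n c) (t c)
      by-parts c = fundamental-theorem-combination (ibp-primitive p n c) (Apiece p c *ₚ Bpiece (suc n) c) (Apiece (suc p) c *ₚ Bpiece n c)
                     (κ p n) (eval-deriv-ibp-primitive p n c) (t c) (t (suc c))
      Φ[N] : Φ N ≡ ρ * ((- 1ℚ) * e₁ * ((- 1ℚ) * e₂))
      Φ[N] = cong₂ (λ u v → ρ * (u * v))
        (trans (Ē-at-multiple b′ (suc p) a) (cong (_* e₁) (sgnℕ-odd a a-odd)))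
        (trans (cong (Ē-at a′ (suc n)) (ℕ.*-comm a b)) (trans (Ē-at-multiple a′ (suc n) b) (cong (_* e₂) (sgnℕ-odd b b-odd))))
      Φ[0] : Φ 0 ≡ ρ * (1ℚ * e₁ * (1ℚ * e₂))
      Φ[0] = cong₂ (λ u v → ρ * (u * v)) (Ē-at-multiple b′ (suc p) 0) (Ē-at-multiple a′ (suc n) 0)
      cancel : ∀ ρ x y → ρ * ((- 1ℚ) * x * ((- 1ℚ) * y)) - ρ * (1ℚ * x * (1ℚ * y)) ≡ 0ℚ
      cancel = solve-∀ ℚ-ring

    -- the increments telescope within each block of a cells of constant sign (-1)^⌊c/a⌋; summing the
    -- blocks by parts leaves the signed grid values, and the end terms cancel because a and b are odd
    ∑-base-cells : ∀ m → ∑ N (λ c → sgnℕ (c / a) * (Ē-at b′ (suc m) (suc c) - Ē-at b′ (suc m) c)) ≡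
                         - (two * ∑ b (λ j → sgnℕ j * Ē-at b′ (suc m) (j ℕ.* a)))
    ∑-base-cells m = begin
      ∑ N F
        ≡⟨ cong (λ k → ∑ k F) (ℕ.*-comm a b) ⟩
      ∑ (b ℕ.* a) F
        ≡⟨ ∑-* b a F ⟩
      ∑ b (λ j → ∑ a (λ r → F (j ℕ.* a ℕ.+ r)))
        ≡⟨ ∑-cong b (∑-block-telescope (λ j → sgnℕ j) w a′) ⟩
      ∑ b (λ j → sgnℕ j * (v (suc j) - v j))
        ≡⟨ ∑-alternating-telescope b v ⟩
      v 0 - sgnℕ b * v b - two * S
        ≡⟨ cong₂ (λ x y → x - y * v b - two * S) (Ē-at-multiple b′ (suc m) 0) (sgnℕ-odd b b-odd) ⟩
      1ℚ * e - (- 1ℚ) * v b - two * S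
        ≡⟨ cong (λ y → 1ℚ * e - (- 1ℚ) * y - two * S) vb ⟩
      1ℚ * e - (- 1ℚ) * ((- 1ℚ) * e) - two * S
        ≡⟨ cancel e S ⟩
      - (two * S)
        ∎
      where
      w = Ē-at b′ (suc m)
      e = E (suc m) 0ℚ
      F : ℕ → ℚ
      F c = sgnℕ (c / a) * (w (suc c) - w c)
      v : ℕ → ℚ
      v j = w (j ℕ.* a)
      S = ∑ b (λ j → sgnℕ j * v j)
      vb : v b ≡ (- 1ℚ) * e
      vb = trans (cong w (ℕ.*-comm b a)) (trans (Ē-at-multiple b′ (suc m) a) (cong (_* e) (sgnℕ-odd a a-odd)))
      cancel : ∀ e S → 1ℚ * e - (- 1ℚ) * ((- 1ℚ) * e) - (1ℚ + 1ℚ) * S ≡ - ((1ℚ + 1ℚ) * S)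
      cancel = solve-∀ ℚ-ring

    module _ (a⊥b : Coprime a b) where

      -- j ↦ j a mod b permutes the residues, and the signs match by parity
      ∑-signed-grid-values : ∀ m → ∑ b (λ j → sgnℕ j * Ē-at b′ (suc m) (j ℕ.* a)) ≡ ∑ b (λ r → sgnℕ r * E (suc m) (r ÷ b))
      ∑-signed-grid-values m = trans (∑-cong b term) (∑-*% a b′ a⊥b h)
        where
        h : ℕ → ℚ
        h r = sgnℕ r * E (suc m) (r ÷ b)
        term : ∀ j → sgnℕ j * Ē-at b′ (suc m) (j ℕ.* a) ≡ h ((j ℕ.* a) % b)
        term j = begin
          sgnℕ j * (sgnℕ q * E (suc m) ((j ℕ.* a) ÷ b - ℕ→ℚ q))   ≡⟨ sym (*-assoc (sgnℕ j) (sgnℕ q) _) ⟩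
          sgnℕ j * sgnℕ q * E (suc m) ((j ℕ.* a) ÷ b - ℕ→ℚ q)     ≡⟨ cong₂ (λ s z → s * E (suc m) z) (sgnℕ-*-/-parity j a b a-odd b-odd)
                                                                                                   (u÷n-u/n≡u%n÷n (j ℕ.* a) b′) ⟩
          h ((j ℕ.* a) % b)                                      ∎
          where
          q = (j ℕ.* a) / b

      integral-base : ∀ m → integral m 0 ≡ recip (a ℕ.* suc m) * - (two * (recip b ^ℚ suc m * E (suc m) 0ℚ))
      integral-base m = begin
        integral m 0
          ≡⟨ integral≡∑ m 0 ⟩
        ∑ N (λ c → ∫poly (Apiece m c *ₚ Bpiece 0 c) (t c) (t (suc c)))
          ≡⟨ ∑-cong N (base-cell m) ⟩
        ∑ N (λ c → ρ * F c)
          ≡⟨ sym (*-distribˡ-∑ N ρ F) ⟩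
        ρ * ∑ N F
          ≡⟨ cong (ρ *_) (∑-base-cells m) ⟩
        ρ * - (two * ∑ b (λ j → sgnℕ j * Ē-at b′ (suc m) (j ℕ.* a)))
          ≡⟨ cong (λ z → ρ * - (two * z)) (∑-signed-grid-values m) ⟩
        ρ * - (two * ∑ b (λ r → sgnℕ r * E (suc m) (r ÷ b)))
          ≡⟨ cong (λ z → ρ * - (two * z)) (signed-Euler-sum (suc m) b′ b-odd) ⟩
        ρ * - (two * (recip b ^ℚ suc m * E (suc m) 0ℚ))
          ∎
        where
        ρ = recip (a ℕ.* suc m)
        F : ℕ → ℚ
        F c = sgnℕ (c / a) * (Ē-at b′ (suc m) (suc c) - Ē-at b′ (suc m) c)

      integral≡closed-form : ∀ n p → integral p n ≡ closed-form p n
      integral≡closed-form zero    p = trans (integral-base p) (closed-form-base p)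
      integral≡closed-form (suc n) p = begin
        integral p (suc n)                   ≡⟨ x+y≡0⇒x≡-y _ _ (integral-by-parts p n) ⟩
        - (κ p n * integral (suc p) n)       ≡⟨ cong (λ z → - (κ p n * z)) (integral≡closed-form n (suc p)) ⟩
        - (κ p n * closed-form (suc p) n)    ≡⟨ closed-form-step p n ⟩
        closed-form p (suc n)                ∎

open import Defs
open import Data.Nat using (ℕ; _%_; _+_; _*_; _^_; _<_)
open import Data.Nat.Coprimality using (Coprime)
open import Data.Nat.Combinatorics using (_C_)
open import Data.Rational using (ℚ; 0ℚ) renaming (_*_ to _*ℚ_)
open import Data.Product using (_×_)
open import Relation.Binary.PropositionalEquality using (_≡_)
open import Data.Nat using (suc)
import Data.Nat.Properties as ℕ
open import Data.Product using (_,_)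
open import Relation.Binary.PropositionalEquality using (cong; sym; module ≡-Reasoning)
open import Data.Rational.Properties using (*-assoc)
open Arithmetic using (recip-homo-*)
open PiecewiseIntegral using (∫₀¹-unique)

lemma2p6 : (a b p n : ℕ) → 0 < a → 0 < b → a % 2 ≡ 1 → b % 2 ≡ 1 → Coprime a b →
             let f = λ (x : ℚ) → Ebar p (ℕ→ℚ a *ℚ x) *ℚ Ebar n (ℕ→ℚ b *ℚ x) in
             PiecewisePoly01 f ×
             ((R : PiecewisePoly01 f) →
               ∫₀¹ R ≡ ((ℕ→ℚ 2 *ℚ sgnℕ (n + 1))
                         *ℚ recip ((n + 1) * ((p + n + 1) C (n + 1)))
                         *ℚ recip ((a ^ (n + 1)) * (b ^ (p + 1)))
                         *ℚ E (p + n + 1) 0ℚ))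
lemma2p6 (suc a′) (suc b′) p n _ _ a-odd b-odd a⊥b = product-piecewise p n , value
  where
  open ProductIntegral a′ b′
  open ≡-Reasoning
  formula : ℕ → ℕ → ℕ → ℚ
  formula k l r = (ℕ→ℚ 2 *ℚ sgnℕ k) *ℚ recip (k * (l C k)) *ℚ recip ((a ^ k) * (b ^ r)) *ℚ E l 0ℚ
  value : (R : PiecewisePoly01 (product p n)) → ∫₀¹ R ≡ formula (n + 1) (p + n + 1) (p + 1)
  value R = begin
    ∫₀¹ R                                          ≡⟨ ∫₀¹-unique R (product-piecewise p n) ⟩
    integral p n                                   ≡⟨ integral≡closed-form a-odd b-odd a⊥b n p ⟩
    ℕ→ℚ 2 *ℚ s *ℚ recip (X * Y) *ℚ e               ≡⟨ cong (λ r → ℕ→ℚ 2 *ℚ s *ℚ r *ℚ e) (recip-homo-* X Y) ⟩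
    ℕ→ℚ 2 *ℚ s *ℚ (recip X *ℚ recip Y) *ℚ e        ≡⟨ cong (_*ℚ e) (sym (*-assoc (ℕ→ℚ 2 *ℚ s) (recip X) (recip Y))) ⟩
    formula (suc n) (suc (p + n)) (suc p)            ≡⟨ cong (λ k → formula k (suc (p + n)) (suc p)) (ℕ.+-comm 1 n) ⟩
    formula (n + 1) (suc (p + n)) (suc p)            ≡⟨ cong (λ l → formula (n + 1) l (suc p)) (ℕ.+-comm 1 (p + n)) ⟩
    formula (n + 1) (p + n + 1) (suc p)              ≡⟨ cong (formula (n + 1) (p + n + 1)) (ℕ.+-comm 1 p) ⟩
    formula (n + 1) (p + n + 1) (p + 1)              ∎
    where
    s = sgnℕ (suc n)
    e = E (suc (p + n)) 0ℚ
    X = suc n * (suc (p + n) C suc n)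
    Y = a ^ suc n * b ^ suc p
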